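{- Let $k$ be a field and let $\gamma\in\mathcal P_{n,r}$, $\delta\in\mathcal P_{m,s}$ with $n,m\ge1$. In $k[\mathcal P_\infty]$ the following hold (sums over $\omega\in\mathcal P_{n+m}$ in the indicated intervals for $\le_B$): $$\gamma\succ\delta=\sum_{\gamma\times\delta\le_B\omega\le_B(\xi_{r,s-1}\times1_1)\circ(\gamma\times\delta)}\omega,$$ $$\gamma\cdot\delta=\sum_{z(r-1,s-1,0)\circ(\gamma\times\delta)\le_B\omega\le_B(\xi_{r-1,s-1}\times1_1)\circ z(r-1,s-1,0)\circ(\gamma\times\delta)}\omega,$$ $$\gamma\prec\delta=\sum_{z(r-1,s)\circ(\gamma\times\delta)\le_B\omega\le_B\xi_{r,s}\circ(\gamma\times\delta)}\omega,$$ $$\gamma*\delta=\sum_{\gamma\times\delta\le_B\omega\le_B\xi_{r,s}\circ(\gamma\times\delta)}\omega.$$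
   Context: For $N\ge1$, $\mathcal P_N$ is the set of surjective maps $\gamma:\{1,\dots,N\}\to\{1,\dots,r\}$ ($r\ge1$), $\mathcal P_{N,r}$ those with image $\{1,\dots,r\}$; $\mathcal P_0=\{(0)\}$; $\mathcal P_\infty=\bigsqcup_{N\ge0}\mathcal P_N$ and $k[\mathcal P_\infty]$ is the $k$-vector space with basis $\mathcal P_\infty$. Write $\gamma=(\gamma(1),\dots,\gamma(N))$; composition is composition of maps; $1_1=(1)$. For $\gamma\in\mathcal P_{N,r}$, $\delta\in\mathcal P_{M,s}$: $\gamma\times\delta=(\gamma(1),\dots,\gamma(N),\delta(1)+r,\dots,\delta(M)+r)\in\mathcal P_{N+M,r+s}$; $\gamma\times(0)=\gamma$. Weak Bruhat order on $\mathcal P_N$: for $r\ge2$, $1\le i\le r-1$, let $t_i\in\mathcal P_{r,r-1}$, $t_i(j)=j$ ($j\le i$), $j-1$ ($j>i$); $\le_B$ is the reflexive transitive closure of $\gamma<_B t_i\circ\gamma$ when every element of $\gamma^{ -1}(i)$ is less than every element of $\gamma^{ -1}(i+1)$, and $t_i\circ\gamma<_B\gamma$ when every element of $\gamma^{ -1}(i)$ is greater than every element of $\gamma^{ -1}(i+1)$. $SH(r,s)$ is the set of $\omega\in\mathcal P_{r+s}$ with $\omega(1)<\dots<\omega(r)$ and $\omega(r+1)<\dots<\omega(r+s)$; $SH^{\succ}(r,s)$, $SH^{\bullet}(r,s)$, $SH^{\prec}(r,s)$ are its subsets with $\omega(r)<\omega(r+s)$, $=$, $>$ respectively. The operations on basis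 elements are $\gamma\succ\delta=\sum_{\omega\in SH^{\succ}(r,s)}\omega\circ(\gamma\times\delta)$, $\gamma\cdot\delta=\sum_{\omega\in SH^{\bullet}(r,s)}\omega\circ(\gamma\times\delta)$, $\gamma\prec\delta=\sum_{\omega\in SH^{\prec}(r,s)}\omega\circ(\gamma\times\delta)$, and $\gamma*\delta=\gamma\succ\delta+\gamma\cdot\delta+\gamma\prec\delta=\sum_{\omega\in SH(r,s)}\omega\circ(\gamma\times\delta)$. $\xi_{a,b}$ is the permutation of $\{1,\dots,a+b\}$ with $\xi_{a,b}(k)=k+b$ for $k\le a$, $k-a$ for $k>a$. $z(a,b,0)=(1,\dots,a,a+b+1,a+1,\dots,a+b+1)\in\mathcal P_{a+b+2,a+b+1}$ and $z(a,b)=(1,\dots,a,a+b+1,a+1,\dots,a+b)$, a permutation of $\{1,\dots,a+b+1\}$. -}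

module Defs where

open import Level using (Level; _⊔_) renaming (suc to lsuc)
open import Data.Nat using (ℕ; zero; suc; _+_)
open import Data.Nat.Properties using (+-comm; +-suc; +-assoc)
open import Data.Fin using (Fin; zero; suc; inject₁; _↑ˡ_; _↑ʳ_; fromℕ; cast)
  renaming (_<_ to _<ᶠ_)
import Data.Fin.Properties as FinP
open import Data.Vec using (Vec; []; _∷_; _++_; map; lookup; allFin; take; drop; last; toList)
import Data.Vec.Properties as VecP
open import Data.Vec.Membership.Propositional using (_∈_)
open import Data.Vec.Relation.Unary.Any using (any?)
import Data.List as L
open import Data.List using (List; []; _∷_; concatMap; filter; upTo)
open import Data.List.Relation.Unary.Linked using (Linked; linked?)
open import Data.Product using (Σ; Σ-syntax; _×_; _,_; proj₁; proj₂)
import Data.Product.Properties as ProdP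
open import Data.Product.Properties using ()
open import Relation.Binary.PropositionalEquality using (_≡_; refl; sym; trans; cong)
open import Relation.Binary.Definitions using (DecidableEquality)
open import Relation.Binary.Construct.Closure.ReflexiveTransitive using (Star)
open import Relation.Nullary using (¬_; Dec; yes; no)
open import Relation.Nullary.Decidable using (_×-dec_)
open import Algebra.Bundles using (CommutativeRing)

record Field c ℓ : Set (lsuc (c ⊔ ℓ)) where
  field
    commutativeRing : CommutativeRing c ℓ
  open CommutativeRing commutativeRing public
  field
    0≉1     : ¬ (0# ≈ 1#)
    inverse : ∀ x → ¬ (x ≈ 0#) → Σ Carrier λ y → x * y ≈ 1#

-- Maps {1..N} → {1..r}, encoded 0-indexed as vectors  Vec (Fin r) N
-- (value j : Fin r stands for j+1, position p : Fin N for p+1).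

Obj : ℕ → Set
Obj N = Σ ℕ λ r → Vec (Fin r) N

-- raw basis candidates of k[P_∞]: (N , r , γ)
Basis : Set
Basis = Σ ℕ Obj

_≟B_ : DecidableEquality Basis
_≟B_ = ProdP.≡-dec Data.Nat._≟_
         (ProdP.≡-dec Data.Nat._≟_ (VecP.≡-dec FinP._≟_))

Surj : ∀ {r N} → Vec (Fin r) N → Set
Surj {r} γ = ∀ (j : Fin r) → j ∈ γ

surj? : ∀ {r N} (γ : Vec (Fin r) N) → Dec (Surj γ)
surj? γ = FinP.all? (λ j → any? (FinP._≟_ j) γ)

-- membership in P_∞ : surjective maps (N = 0, r = 0 gives the element (0))
InP∞ : Basis → Set
InP∞ (N , r , γ) = Surj γ

comp : ∀ {t a r N} → Vec (Fin t) a → Vec (Fin r) N → r ≡ a → Vec (Fin t) N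
comp ω γ eq = map (λ x → lookup ω (cast eq x)) γ

_⊠_ : ∀ {r n s m} → Vec (Fin r) n → Vec (Fin s) m → Vec (Fin (r + s)) (n + m)
_⊠_ {r} {n} {s} γ δ = map (_↑ˡ s) γ ++ map (r ↑ʳ_) δ

one₁ : Vec (Fin 1) 1
one₁ = zero ∷ []

-- ξ_{a,b} : k ↦ k+b (k ≤ a), k ↦ k−a (k > a)
ξ : ∀ a b → Vec (Fin (a + b)) (a + b)
ξ a b = map (λ i → cast (+-comm b a) (b ↑ʳ i)) (allFin a)
     ++ map (λ j → cast (+-comm b a) (j ↑ˡ a)) (allFin b)

-- z(a,b,0) = (1,…,a, a+b+1, a+1,…,a+b+1) = id_a × (b+1, 1, 2, …, b+1)
z₀ : ∀ a b → Vec (Fin (a + suc b)) (a + suc (suc b))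
z₀ a b = allFin a ⊠ (fromℕ b ∷ allFin (suc b))

-- z(a,b) = (1,…,a, a+b+1, a+1,…,a+b) = id_a × (b+1, 1, …, b)
z : ∀ a b → Vec (Fin (a + suc b)) (a + suc b)
z a b = allFin a ⊠ (fromℕ b ∷ map inject₁ (allFin b))

-- t_i for i ∈ {1,…,r−1}, r = suc (suc n), with i = i₀+1 for i₀ : Fin (suc n):
-- t_i(j) = j (j ≤ i), j−1 (j > i)
tmap : ∀ {n} → Fin (suc n) → Fin (suc (suc n)) → Fin (suc n)
tmap zero zero = zero
tmap zero (suc j) = j
tmap {suc n} (suc i) zero = zero
tmap {suc n} (suc i) (suc j) = suc (tmap i j)

BlocksLt : ∀ {n N} → Vec (Fin (suc (suc n))) N → Fin (suc n) → Set
BlocksLt {N = N} γ i = ∀ (p q : Fin N) →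
  lookup γ p ≡ inject₁ i → lookup γ q ≡ suc i → p <ᶠ q

BlocksGt : ∀ {n N} → Vec (Fin (suc (suc n))) N → Fin (suc n) → Set
BlocksGt {N = N} γ i = ∀ (p q : Fin N) →
  lookup γ p ≡ inject₁ i → lookup γ q ≡ suc i → q <ᶠ p

data BStep {N : ℕ} : Obj N → Obj N → Set where
  up   : ∀ {n} (γ : Vec (Fin (suc (suc n))) N) (i : Fin (suc n)) →
         Surj γ → BlocksLt γ i →
         BStep (suc (suc n) , γ) (suc n , map (tmap i) γ)
  down : ∀ {n} (γ : Vec (Fin (suc (suc n))) N) (i : Fin (suc n)) →
         Surj γ → BlocksGt γ i →
         BStep (suc n , map (tmap i) γ) (suc (suc n) , γ)

_≤B_ : ∀ {N} → Obj N → Obj N → Set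
_≤B_ = Star BStep

InInterval : ∀ {N} → Obj N → Obj N → Basis → Set
InInterval {N} lo hi τ = Σ (Obj N) λ ω → (τ ≡ (N , ω)) × (lo ≤B ω) × (ω ≤B hi)

allVecs : ∀ t N → List (Vec (Fin t) N)
allVecs t zero = [] ∷ []
allVecs t (suc N) = concatMap (λ x → L.map (x ∷_) (allVecs t N)) (L.allFin t)

-- all elements of P_N (codomain sizes 0,…,N suffice for surjections)
allP : ∀ N → List (Obj N)
allP N = filter (λ o → surj? (proj₂ o))
           (concatMap (λ t → L.map (t ,_) (allVecs t N)) (upTo (suc N)))

Increasing : ∀ {t k} → Vec (Fin t) k → Set
Increasing v = Linked _<ᶠ_ (toList v)

increasing? : ∀ {t k} (v : Vec (Fin t) k) → Dec (Increasing v)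
increasing? v = linked? FinP._<?_ (toList v)

-- shuffle condition, for r = suc r₁, s = suc s₁
IsShuffle : ∀ r₁ s₁ → Obj (suc r₁ + suc s₁) → Set
IsShuffle r₁ s₁ (t , ω) =
  Increasing (take (suc r₁) ω) × Increasing (drop (suc r₁) ω)

isShuffle? : ∀ r₁ s₁ (o : Obj (suc r₁ + suc s₁)) → Dec (IsShuffle r₁ s₁ o)
isShuffle? r₁ s₁ (t , ω) =
  increasing? (take (suc r₁) ω) ×-dec increasing? (drop (suc r₁) ω)

ωr ωrs : ∀ r₁ s₁ → (o : Obj (suc r₁ + suc s₁)) → Fin (proj₁ o)
ωr  r₁ s₁ (t , ω) = last (take (suc r₁) ω)
ωrs r₁ s₁ (t , ω) = last (drop (suc r₁) ω)

SH : ∀ r₁ s₁ → List (Obj (suc r₁ + suc s₁))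
SH r₁ s₁ = filter (isShuffle? r₁ s₁) (allP (suc r₁ + suc s₁))

SH≻ SH• SH≺ : ∀ r₁ s₁ → List (Obj (suc r₁ + suc s₁))
SH≻ r₁ s₁ = filter (λ o → ωr r₁ s₁ o FinP.<? ωrs r₁ s₁ o) (SH r₁ s₁)
SH• r₁ s₁ = filter (λ o → ωr r₁ s₁ o FinP.≟ ωrs r₁ s₁ o) (SH r₁ s₁)
SH≺ r₁ s₁ = filter (λ o → ωrs r₁ s₁ o FinP.<? ωr r₁ s₁ o) (SH r₁ s₁)

-- the formal sum  Σ_{ω ∈ S} ω ∘ (γ × δ)  as a list of basis elements
shuffleSum : ∀ {r₁ s₁ n m} → List (Obj (suc r₁ + suc s₁)) →
             Vec (Fin (suc r₁)) n → Vec (Fin (suc s₁)) m → List Basis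
shuffleSum {n = n} {m} S γ δ =
  L.map (λ o → (n + m , proj₁ o , comp (proj₂ o) (γ ⊠ δ) refl)) S

-- k[P_∞]: an element is given by its coefficient function on P_∞.

coeff : ∀ {c ℓ} (k : Field c ℓ) → List Basis → Basis → Field.Carrier k
coeff k [] τ = Field.0# k
coeff k (x ∷ xs) τ with x ≟B τ
... | yes _ = Field._+_ k (Field.1# k) (coeff k xs τ)
... | no  _ = coeff k xs τ

-- the element with coefficients f equals Σ_{ω ∈ S} ω  in k[P_∞]
-- (S a set of elements of P_∞): coefficient 1 on S, 0 elsewhere on P_∞
_≐Σ_ : ∀ {c ℓ} {k : Field c ℓ} → (Basis → Field.Carrier k) → (Basis → Set) → Set ℓ
_≐Σ_ {k = k} f S = ∀ τ → InP∞ τ →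
  (S τ → Field._≈_ k (f τ) (Field.1# k)) × (¬ S τ → Field._≈_ k (f τ) (Field.0# k))

eq≻ : ∀ r₁ s₁ → suc r₁ + suc s₁ ≡ (suc r₁ + s₁) + 1
eq≻ r₁ s₁ = trans (+-suc (suc r₁) s₁) (+-comm 1 (suc r₁ + s₁))

eq•₁ : ∀ r₁ s₁ → suc r₁ + suc s₁ ≡ r₁ + suc (suc s₁)
eq•₁ r₁ s₁ = sym (+-suc r₁ (suc s₁))

eq•₂ : ∀ r₁ s₁ → r₁ + suc s₁ ≡ (r₁ + s₁) + 1
eq•₂ r₁ s₁ = trans (+-suc r₁ s₁) (+-comm 1 (r₁ + s₁))

eq≺ : ∀ r₁ s₁ → suc r₁ + suc s₁ ≡ r₁ + suc (suc s₁)
eq≺ r₁ s₁ = sym (+-suc r₁ (suc s₁))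

{-# OPTIONS --safe #-}

-- Write a surjective shuffle ω ∈ SH(r,s) as the word recording, value by value, whether the value
-- is hit by the first block, by the second, or by both. Fusing two adjacent values hit by different
-- blocks into one hit by both is a weak Bruhat step of ω ∘ (γ × δ), upwards when the first block
-- comes first; and every word is joined by such fusions and their inverses to the word of γ × δ
-- below it and to that of ξ_{r,s} ∘ (γ × δ) above it. So every term of γ * δ lies in the interval,
-- and distinct shuffles give distinct terms because γ × δ is surjective.
-- Conversely, for positions p < q the comparison of ω(p) with ω(q) (<, =, >) can only increase
-- along ≤_B, so a comparison that agrees at both ends of an interval is constant on it. Inside γ
-- and inside δ the comparisons at both ends are those of γ and δ, which forces every element of
-- the interval to factor as a shuffle after γ × δ. The refined identities for ≻, · and ≺ fix in
-- addition the last letter of the word, i.e. how ω(r) compares with ω(r+s), and this comparison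
-- is again frozen between the corresponding endpoints.

module Submission where

open import Defs
open import Data.Empty using (⊥-elim)
open import Data.Fin using (Fin; zero; suc; toℕ; inject₁; fromℕ; fromℕ<; cast; _↑ˡ_; _↑ʳ_; splitAt)
  renaming (_<_ to _<ᶠ_)
import Data.Fin.Properties as FinP
open import Data.List using (List; []; _∷_; concatMap; filter)
import Data.List as List
open import Data.List.Membership.Propositional using () renaming (_∈_ to _∈ₗ_; _∉_ to _∉ₗ_)
open import Data.List.Membership.Propositional.Properties
  using (∈-map⁺; ∈-map⁻; ∈-concatMap⁺; ∈-filter⁺; ∈-filter⁻; ∈-upTo⁺; ∈-allFin)
open import Data.List.Relation.Unary.All using ([])
import Data.List.Relation.Unary.All as All
import Data.List.Relation.Unary.All.Properties as AllP
open import Data.List.Relation.Unary.AllPairs using ([]; _∷_)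
import Data.List.Relation.Unary.AllPairs as AllPairs
import Data.List.Relation.Unary.AllPairs.Properties as AllPairsP
open import Data.List.Relation.Unary.Any using (here; there)
import Data.List.Relation.Unary.Any as AnyL
open import Data.List.Relation.Unary.Linked using ([]; [-]; _∷_)
open import Data.List.Relation.Unary.Unique.Propositional using (Unique)
import Data.List.Relation.Unary.Unique.Propositional.Properties as UniqueP
open import Data.Nat using (ℕ; zero; suc; pred; _+_; _≤_; _<_; z≤n; s≤s; s<s⁻¹; z<s; s<s; >-nonZero)
open import Data.Nat.Properties
  using (<-cmp; ≤-refl; ≤-trans; ≤-antisym; ≤-reflexive; <-asym; <-trans; <-≤-trans; <⇒≤; m≤m+n;
         +-monoʳ-<; +-comm; +-suc; +-identityʳ; _≟_; suc-pred; n≢0⇒n>0; 0≢1+n; suc-injective;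
         ≡-irrelevant; n≮0)
open import Data.Product using (Σ; ∃; _×_; _,_; proj₁; proj₂)
import Data.Product as Product
open import Data.Product.Properties using (,-injectiveˡ; ,-injectiveʳ-UIP)
open import Data.Sum using (_⊎_; inj₁; inj₂)
import Data.Sum as Sum
open import Data.Unit using (⊤; tt)
open import Data.Vec using (Vec; []; _∷_; _++_; map; lookup; tabulate; take; drop; last; allFin)
import Data.Vec as Vec
open import Data.Vec.Membership.Propositional using () renaming (_∈_ to _∈ᵥ_)
import Data.Vec.Membership.Propositional.Properties as VecM
import Data.Vec.Properties as VecP
import Data.Vec.Relation.Unary.Any as AnyV
import Data.Vec.Relation.Unary.Any.Properties as AnyVP
open import Function using (_∘_; case_of_)
open import Relation.Binary.Construct.Closure.ReflexiveTransitive using (Star; ε; _◅_; _◅◅_; gmap)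
open import Relation.Binary.Core using (_Preserves_⟶_)
open import Relation.Binary.Definitions using (tri<; tri≈; tri>)
open import Relation.Binary.PropositionalEquality
open import Relation.Nullary using (¬_; contradiction; yes; no)
open import Relation.Unary using (Decidable)

private variable
  n N r s t k : ℕ

data SplitView (m n : ℕ) : Fin (m + n) → Set where
  inl : (a : Fin m) → SplitView m n (a ↑ˡ n)
  inr : (b : Fin n) → SplitView m n (m ↑ʳ b)

splitView : ∀ m n (i : Fin (m + n)) → SplitView m n i
splitView m n i with splitAt m i in eq
... | inj₁ a = subst (SplitView m n) (FinP.splitAt⁻¹-↑ˡ eq) (inl a)
... | inj₂ b = subst (SplitView m n) (FinP.splitAt⁻¹-↑ʳ eq) (inr b)

module _ {A B C : Set} {m n : ℕ} (f : A → C) (g : B → C) (xs : Vec A m) (ys : Vec B n) where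

  lookup-map-++ˡ : ∀ a → lookup (map f xs ++ map g ys) (a ↑ˡ n) ≡ f (lookup xs a)
  lookup-map-++ˡ a = trans (VecP.lookup-++ˡ (map f xs) (map g ys) a) (VecP.lookup-map a f xs)

  lookup-map-++ʳ : ∀ b → lookup (map f xs ++ map g ys) (m ↑ʳ b) ≡ g (lookup ys b)
  lookup-map-++ʳ b = trans (VecP.lookup-++ʳ (map f xs) (map g ys) b) (VecP.lookup-map b g ys)

vec-ext : ∀ {A : Set} {xs ys : Vec A n} → (∀ i → lookup xs i ≡ lookup ys i) → xs ≡ ys
vec-ext {xs = xs} {ys} eq =
  trans (sym (VecP.tabulate∘lookup xs)) (trans (VecP.tabulate-cong eq) (VecP.tabulate∘lookup ys))

↑ˡ<↑ʳ : ∀ {m n} (a : Fin m) (b : Fin n) → a ↑ˡ n <ᶠ m ↑ʳ b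
↑ˡ<↑ʳ {m} {n} a b = subst₂ _<_ (sym (FinP.toℕ-↑ˡ a n)) (sym (FinP.toℕ-↑ʳ m b))
  (<-≤-trans (FinP.toℕ<n a) (m≤m+n m (toℕ b)))

↑ˡ-mono-< : ∀ {m} n {a a' : Fin m} → a <ᶠ a' → a ↑ˡ n <ᶠ a' ↑ˡ n
↑ˡ-mono-< n {a} {a'} = subst₂ _<_ (sym (FinP.toℕ-↑ˡ a n)) (sym (FinP.toℕ-↑ˡ a' n))

↑ʳ-mono-< : ∀ m {n} {b b' : Fin n} → b <ᶠ b' → m ↑ʳ b <ᶠ m ↑ʳ b'
↑ʳ-mono-< m {b = b} {b'} = subst₂ _<_ (sym (FinP.toℕ-↑ʳ m b)) (sym (FinP.toℕ-↑ʳ m b')) ∘ +-monoʳ-< m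

module _ {A : Set} {m n : ℕ} (xs : Vec A m) (ys : Vec A n) where

  take-++ : take m (xs ++ ys) ≡ xs
  take-++ = VecP.++-injectiveˡ _ xs (VecP.take++drop≡id m (xs ++ ys))

  drop-++ : drop m (xs ++ ys) ≡ ys
  drop-++ = VecP.++-injectiveʳ _ xs (VecP.take++drop≡id m (xs ++ ys))

last≡lookup-fromℕ : ∀ {A : Set} (xs : Vec A (suc n)) → last xs ≡ lookup xs (fromℕ n)
last≡lookup-fromℕ (x ∷ [])     = refl
last≡lookup-fromℕ (x ∷ y ∷ xs) = last≡lookup-fromℕ (y ∷ xs)

tabulate-increasing : {f : Fin n → Fin t} → f Preserves _<ᶠ_ ⟶ _<ᶠ_ → Increasing (tabulate f)
tabulate-increasing {zero}        mono = []
tabulate-increasing {suc zero}    mono = [-]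
tabulate-increasing {suc (suc n)} mono = mono z<s ∷ tabulate-increasing (mono ∘ s<s)

increasing⇒lookup-strictMono : (v : Vec (Fin t) n) → Increasing v → lookup v Preserves _<ᶠ_ ⟶ _<ᶠ_
increasing⇒lookup-strictMono (x ∷ y ∷ v) (x<y ∷ _) {zero} {suc zero} _ = x<y
increasing⇒lookup-strictMono (x ∷ y ∷ v) (x<y ∷ inc) {zero} {suc (suc j)} _ =
  <-trans x<y (increasing⇒lookup-strictMono (y ∷ v) inc {zero} {suc j} z<s)
increasing⇒lookup-strictMono (x ∷ y ∷ v) (_ ∷ inc) {suc i} {suc j} i<j =
  increasing⇒lookup-strictMono (y ∷ v) inc (s<s⁻¹ i<j)
increasing⇒lookup-strictMono (x ∷ []) _ {zero} {suc ()}

++-ext : ∀ {A : Set} {m n} {xs ys : Vec A (m + n)} →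
         (∀ a → lookup xs (a ↑ˡ n) ≡ lookup ys (a ↑ˡ n)) →
         (∀ b → lookup xs (m ↑ʳ b) ≡ lookup ys (m ↑ʳ b)) → xs ≡ ys
++-ext {m = m} {n} {xs} {ys} onL onR = vec-ext λ i → go i (splitView m n i)
  where
  go : ∀ i → SplitView m n i → lookup xs i ≡ lookup ys i
  go _ (inl a) = onL a
  go _ (inr b) = onR b

module _ {A : Set} (m : ℕ) {n : ℕ} (xs : Vec A (m + n)) where

  lookup-take : ∀ a → lookup (take m xs) a ≡ lookup xs (a ↑ˡ n)
  lookup-take a = trans (sym (VecP.lookup-++ˡ (take m xs) (drop m xs) a))
                        (cong (λ ys → lookup ys (a ↑ˡ n)) (VecP.take++drop≡id m xs))

  lookup-drop : ∀ b → lookup (drop m xs) b ≡ lookup xs (m ↑ʳ b)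
  lookup-drop b = trans (sym (VecP.lookup-++ʳ (take m xs) (drop m xs) b))
                        (cong (λ ys → lookup ys (m ↑ʳ b)) (VecP.take++drop≡id m xs))

tabulate₂ : ∀ {A : Set} → (Fin r → A) → (Fin s → A) → Vec A (r + s)
tabulate₂ f g = tabulate f ++ tabulate g

module _ {A : Set} (f : Fin r → A) (g : Fin s → A) where

  lookup-tabulate₂-↑ˡ : ∀ a → lookup (tabulate₂ f g) (a ↑ˡ s) ≡ f a
  lookup-tabulate₂-↑ˡ a = trans (VecP.lookup-++ˡ (tabulate f) _ a) (VecP.lookup∘tabulate f a)

  lookup-tabulate₂-↑ʳ : ∀ b → lookup (tabulate₂ f g) (r ↑ʳ b) ≡ g b
  lookup-tabulate₂-↑ʳ b = trans (VecP.lookup-++ʳ (tabulate f) _ b) (VecP.lookup∘tabulate g b)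

module _ (f : Fin (suc r) → Fin t) (g : Fin (suc s) → Fin t) where

  ωr-tabulate₂ : ωr r s (t , tabulate₂ f g) ≡ f (fromℕ r)
  ωr-tabulate₂ = trans (cong last (take-++ (tabulate f) (tabulate g)))
    (trans (last≡lookup-fromℕ (tabulate f)) (VecP.lookup∘tabulate f _))

  ωrs-tabulate₂ : ωrs r s (t , tabulate₂ f g) ≡ g (fromℕ s)
  ωrs-tabulate₂ = trans (cong last (drop-++ (tabulate f) (tabulate g)))
    (trans (last≡lookup-fromℕ (tabulate g)) (VecP.lookup∘tabulate g _))

  tabulate₂-shuffle : f Preserves _<ᶠ_ ⟶ _<ᶠ_ → g Preserves _<ᶠ_ ⟶ _<ᶠ_ →
                      IsShuffle r s (t , tabulate₂ f g)
  tabulate₂-shuffle f-mono g-mono =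
    subst Increasing (sym (take-++ (tabulate f) (tabulate g))) (tabulate-increasing f-mono) ,
    subst Increasing (sym (drop-++ (tabulate f) (tabulate g))) (tabulate-increasing g-mono)

data LastView : Fin (suc n) → Set where
  is-last   : LastView (fromℕ n)
  is-inject : (a : Fin n) → LastView (inject₁ a)

lastView : (a : Fin (suc n)) → LastView a
lastView {zero}  zero    = is-last
lastView {suc n} zero    = is-inject zero
lastView {suc n} (suc a) with lastView a
... | is-last     = is-last
... | is-inject a = is-inject (suc a)

-- Comparison codes

cmpCode : ℕ → ℕ → ℕ
cmpCode x y with <-cmp x y
... | tri< _ _ _ = 0
... | tri≈ _ _ _ = 1
... | tri> _ _ _ = 2

module _ {x y : ℕ} where

  cmpCode-< : x < y → cmpCode x y ≡ 0
  cmpCode-< x<y with <-cmp x y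
  ... | tri< _ _ _ = refl
  ... | tri≈ x≮y _ _ = ⊥-elim (x≮y x<y)
  ... | tri> x≮y _ _ = ⊥-elim (x≮y x<y)

  cmpCode-≡ : x ≡ y → cmpCode x y ≡ 1
  cmpCode-≡ x≡y with <-cmp x y
  ... | tri< _ x≢y _ = ⊥-elim (x≢y x≡y)
  ... | tri≈ _ _ _ = refl
  ... | tri> _ x≢y _ = ⊥-elim (x≢y x≡y)

  cmpCode-> : y < x → cmpCode x y ≡ 2
  cmpCode-> y<x with <-cmp x y
  ... | tri< _ _ y≮x = ⊥-elim (y≮x y<x)
  ... | tri≈ _ _ y≮x = ⊥-elim (y≮x y<x)
  ... | tri> _ _ _ = refl

  cmpCode≡0⇒< : cmpCode x y ≡ 0 → x < y
  cmpCode≡0⇒< eq with <-cmp x y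
  ... | tri< x<y _ _ = x<y

  cmpCode≡1⇒≡ : cmpCode x y ≡ 1 → x ≡ y
  cmpCode≡1⇒≡ eq with <-cmp x y
  ... | tri≈ _ x≡y _ = x≡y

  cmpCode≡2⇒> : cmpCode x y ≡ 2 → y < x
  cmpCode≡2⇒> eq with <-cmp x y
  ... | tri> _ _ y<x = y<x

  cmpCode≤2 : cmpCode x y ≤ 2
  cmpCode≤2 with <-cmp x y
  ... | tri< _ _ _ = z≤n
  ... | tri≈ _ _ _ = s≤s z≤n
  ... | tri> _ _ _ = ≤-refl

cmpᶠ : Fin t → Fin t → ℕ
cmpᶠ x y = cmpCode (toℕ x) (toℕ y)

cmpᶠ-≡ : {x y : Fin t} → x ≡ y → cmpᶠ x y ≡ 1
cmpᶠ-≡ x≡y = cmpCode-≡ (cong toℕ x≡y)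

cmpᶠ-strictMono : ∀ {f : Fin k → Fin t} → f Preserves _<ᶠ_ ⟶ _<ᶠ_ →
                  ∀ x y → cmpᶠ (f x) (f y) ≡ cmpᶠ x y
cmpᶠ-strictMono {f = f} mono x y with <-cmp (toℕ x) (toℕ y)
... | tri< x<y _ _ = cmpCode-< (mono x<y)
... | tri≈ _ x≡y _ = cmpᶠ-≡ (cong f (FinP.toℕ-injective x≡y))
... | tri> _ _ y<x = cmpCode-> (mono y<x)

tmap-<-except : (i : Fin (suc n)) {x y : Fin (suc (suc n))} → x <ᶠ y →
                ¬ (x ≡ inject₁ i × y ≡ suc i) → tmap i x <ᶠ tmap i y
tmap-<-except zero {zero} {suc zero} _ ne = ⊥-elim (ne (refl , refl))
tmap-<-except zero {zero} {suc (suc y)} _ _ = z<s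
tmap-<-except zero {suc x} {suc y} x<y _ = s<s⁻¹ x<y
tmap-<-except {suc n} (suc i) {zero} {suc y} _ _ = z<s
tmap-<-except {suc n} (suc i) {suc x} {suc y} x<y ne =
  s<s (tmap-<-except i (s<s⁻¹ x<y) λ (x≡i , y≡i+1) → ne (cong suc x≡i , cong suc y≡i+1))

cmpᶠ-tmap-≥ : (i : Fin (suc n)) (x y : Fin (suc (suc n))) →
              ¬ (y ≡ inject₁ i × x ≡ suc i) → cmpᶠ x y ≤ cmpᶠ (tmap i x) (tmap i y)
cmpᶠ-tmap-≥ i x y ne with <-cmp (toℕ x) (toℕ y)
... | tri< _ _ _ = z≤n
... | tri≈ _ x≡y _ = ≤-reflexive (sym (cmpᶠ-≡ (cong (tmap i) (FinP.toℕ-injective x≡y))))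
... | tri> _ _ y<x = ≤-reflexive (sym (cmpCode-> (tmap-<-except i y<x ne)))

cmpᶠ-tmap-≤ : (i : Fin (suc n)) (x y : Fin (suc (suc n))) →
              ¬ (x ≡ inject₁ i × y ≡ suc i) → cmpᶠ (tmap i x) (tmap i y) ≤ cmpᶠ x y
cmpᶠ-tmap-≤ i x y ne with <-cmp (toℕ x) (toℕ y)
... | tri< x<y _ _ = ≤-reflexive (cmpCode-< (tmap-<-except i x<y ne))
... | tri≈ _ x≡y _ = ≤-reflexive (cmpᶠ-≡ (cong (tmap i) (FinP.toℕ-injective x≡y)))
... | tri> _ _ _ = cmpCode≤2

cmpAt : Obj N → Fin N → Fin N → ℕ
cmpAt (_ , v) p q = cmpᶠ (lookup v p) (lookup v q)

cmpAt-map : ∀ {t'} (f : Fin t → Fin t') (v : Vec (Fin t) N) p q →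
            cmpAt (t' , map f v) p q ≡ cmpᶠ (f (lookup v p)) (f (lookup v q))
cmpAt-map f v p q = cong₂ cmpᶠ (VecP.lookup-map p f v) (VecP.lookup-map q f v)

-- t_i only identifies i with i + 1, and the block condition of a step excludes the one
-- arrangement of i and i + 1 on p < q that would lower the code.
BStep⇒cmpAt-≤ : {o o' : Obj N} → BStep o o' → ∀ {p q} → p <ᶠ q → cmpAt o p q ≤ cmpAt o' p q
BStep⇒cmpAt-≤ (up γ i _ before) {p} {q} p<q =
  subst (_ ≤_) (sym (cmpAt-map (tmap i) γ p q))
    (cmpᶠ-tmap-≥ i _ _ λ (γq≡i , γp≡i+1) → <-asym p<q (before q p γq≡i γp≡i+1))
BStep⇒cmpAt-≤ (down γ i _ after) {p} {q} p<q =
  subst (_≤ _) (sym (cmpAt-map (tmap i) γ p q))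
    (cmpᶠ-tmap-≤ i _ _ λ (γp≡i , γq≡i+1) → <-asym p<q (after p q γp≡i γq≡i+1))

≤B⇒cmpAt-≤ : {o o' : Obj N} → o ≤B o' → ∀ {p q} → p <ᶠ q → cmpAt o p q ≤ cmpAt o' p q
≤B⇒cmpAt-≤ ε p<q = ≤-refl
≤B⇒cmpAt-≤ (step ◅ steps) p<q = ≤-trans (BStep⇒cmpAt-≤ step p<q) (≤B⇒cmpAt-≤ steps p<q)

cmpAt-squeeze : ∀ {lo o hi : Obj N} {p q c} → lo ≤B o → o ≤B hi → p <ᶠ q →
                cmpAt lo p q ≡ c → cmpAt hi p q ≡ c → cmpAt o p q ≡ c
cmpAt-squeeze lo≤o o≤hi p<q refl hi≡c =
  ≤-antisym (subst (_ ≤_) hi≡c (≤B⇒cmpAt-≤ o≤hi p<q)) (≤B⇒cmpAt-≤ lo≤o p<q)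

module _ (g : Vec (Fin k) n) (g-surj : Surj g) where

  section : Fin k → Fin n
  section j = AnyV.index (g-surj j)

  lookup-section : ∀ j → lookup g (section j) ≡ j
  lookup-section j = sym (AnyVP.lookup-index (g-surj j))

  SamePattern : (Fin n → Fin t) → Set
  SamePattern h = ∀ {a a'} → a <ᶠ a' → cmpᶠ (h a) (h a') ≡ cmpᶠ (lookup g a) (lookup g a')

  factorise : (h : Fin n → Fin t) → SamePattern h →
              Σ (Fin k → Fin t) λ F → F Preserves _<ᶠ_ ⟶ _<ᶠ_ × (∀ a → h a ≡ F (lookup g a))
  factorise h same = h ∘ section , F-mono , λ a → h-respects (sym (lookup-section (lookup g a)))
    where
    h-respects : ∀ {a a'} → lookup g a ≡ lookup g a' → h a ≡ h a'
    h-respects {a} {a'} ga≡ga' with <-cmp (toℕ a) (toℕ a')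
    ... | tri< a<a' _ _ = FinP.toℕ-injective (cmpCode≡1⇒≡ (trans (same a<a') (cmpᶠ-≡ ga≡ga')))
    ... | tri≈ _ a≡a' _ = cong h (FinP.toℕ-injective a≡a')
    ... | tri> _ _ a'<a = FinP.toℕ-injective (sym (cmpCode≡1⇒≡ (trans (same a'<a) (cmpᶠ-≡ (sym ga≡ga')))))

    F-mono : (h ∘ section) Preserves _<ᶠ_ ⟶ _<ᶠ_
    F-mono {j} {j'} j<j' with <-cmp (toℕ (section j)) (toℕ (section j'))
    ... | tri< a<a' _ _ = cmpCode≡0⇒< (trans (same a<a')
          (trans (cong₂ cmpᶠ (lookup-section j) (lookup-section j')) (cmpCode-< j<j')))
    ... | tri≈ _ a≡a' _ = contradiction (trans (sym (lookup-section j))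
          (trans (cong (lookup g) (FinP.toℕ-injective a≡a')) (lookup-section j'))) (FinP.<⇒≢ j<j')
    ... | tri> _ _ a'<a = cmpCode≡2⇒> (trans (same a'<a)
          (trans (cong₂ cmpᶠ (lookup-section j') (lookup-section j)) (cmpCode-> j<j')))

surj⇒≤ : (v : Vec (Fin t) N) → Surj v → t ≤ N
surj⇒≤ v v-surj = FinP.injective⇒≤ λ {j} {j'} eq →
  trans (sym (lookup-section v v-surj j)) (trans (cong (lookup v) eq) (lookup-section v v-surj j'))

-- Shuffles as words

-- A surjective shuffle ω ∈ SH(r,s) onto {1,…,t}, as the word listing for each value, from the
-- smallest, whether it is hit by the first block only, by the second block only, or by both.
data Shuffle : ℕ → ℕ → ℕ → Set where
  []   : Shuffle 0 0 0
  l∷_  : Shuffle r s t → Shuffle (suc r) s (suc t)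
  r∷_  : Shuffle r s t → Shuffle r (suc s) (suc t)
  lr∷_ : Shuffle r s t → Shuffle (suc r) (suc s) (suc t)

lmap : Shuffle r s t → Fin r → Fin t
lmap (l∷ w)  zero    = zero
lmap (l∷ w)  (suc a) = suc (lmap w a)
lmap (r∷ w)  a       = suc (lmap w a)
lmap (lr∷ w) zero    = zero
lmap (lr∷ w) (suc a) = suc (lmap w a)

rmap : Shuffle r s t → Fin s → Fin t
rmap (l∷ w)  b       = suc (rmap w b)
rmap (r∷ w)  zero    = zero
rmap (r∷ w)  (suc b) = suc (rmap w b)
rmap (lr∷ w) zero    = zero
rmap (lr∷ w) (suc b) = suc (rmap w b)

lmap-strictMono : (w : Shuffle r s t) → lmap w Preserves _<ᶠ_ ⟶ _<ᶠ_
lmap-strictMono (l∷ w)  {zero}  {suc _} _   = z<s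
lmap-strictMono (l∷ w)  {suc _} {suc _} a<b = s<s (lmap-strictMono w (s<s⁻¹ a<b))
lmap-strictMono (r∷ w)  a<b                 = s<s (lmap-strictMono w a<b)
lmap-strictMono (lr∷ w) {zero}  {suc _} _   = z<s
lmap-strictMono (lr∷ w) {suc _} {suc _} a<b = s<s (lmap-strictMono w (s<s⁻¹ a<b))

rmap-strictMono : (w : Shuffle r s t) → rmap w Preserves _<ᶠ_ ⟶ _<ᶠ_
rmap-strictMono (l∷ w)  a<b                 = s<s (rmap-strictMono w a<b)
rmap-strictMono (r∷ w)  {zero}  {suc _} _   = z<s
rmap-strictMono (r∷ w)  {suc _} {suc _} a<b = s<s (rmap-strictMono w (s<s⁻¹ a<b))
rmap-strictMono (lr∷ w) {zero}  {suc _} _   = z<s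
rmap-strictMono (lr∷ w) {suc _} {suc _} a<b = s<s (rmap-strictMono w (s<s⁻¹ a<b))

lmap-rmap-cover : (w : Shuffle r s t) (j : Fin t) →
                  (∃ λ a → lmap w a ≡ j) ⊎ (∃ λ b → rmap w b ≡ j)
lmap-rmap-cover (l∷ w)  zero    = inj₁ (zero , refl)
lmap-rmap-cover (r∷ w)  zero    = inj₂ (zero , refl)
lmap-rmap-cover (lr∷ w) zero    = inj₁ (zero , refl)
lmap-rmap-cover (l∷ w)  (suc j) =
  Sum.map (Product.map suc (cong suc)) (Product.map₂ (cong suc)) (lmap-rmap-cover w j)
lmap-rmap-cover (r∷ w)  (suc j) =
  Sum.map (Product.map₂ (cong suc)) (Product.map suc (cong suc)) (lmap-rmap-cover w j)
lmap-rmap-cover (lr∷ w) (suc j) =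
  Sum.map (Product.map suc (cong suc)) (Product.map suc (cong suc)) (lmap-rmap-cover w j)

-- f' is f with the value 0 removed from its image and every other value decreased by one.
data Lowering : ∀ {r r'} → (Fin r → ℕ) → (Fin r' → ℕ) → Set where
  hit  : {f : Fin (suc r) → ℕ} {f' : Fin r → ℕ} →
         f zero ≡ 0 → (∀ a → f (suc a) ≡ suc (f' a)) → Lowering f f'
  miss : {f f' : Fin r → ℕ} → (∀ a → f a ≡ suc (f' a)) → Lowering f f'

lowering : (f : Fin r → ℕ) → f Preserves _<ᶠ_ ⟶ _<_ → ∃ λ r' → Σ (Fin r' → ℕ) (Lowering f)
lowering {zero}  f _ = 0 , (λ ()) , miss (λ ())
lowering {suc r} f mono with f zero ≟ 0
... | yes f0≡0 = r , pred ∘ f ∘ suc , hit f0≡0 λ a →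
  sym (suc-pred _ {{>-nonZero (subst (_< f (suc a)) f0≡0 (mono z<s))}})
... | no f0≢0 = suc r , pred ∘ f , miss λ a →
  sym (suc-pred _ {{>-nonZero (<-≤-trans (n≢0⇒n>0 f0≢0) (f0≤ a))}})
  where f0≤ : ∀ a → f zero ≤ f a
        f0≤ zero    = ≤-refl
        f0≤ (suc a) = <⇒≤ (mono z<s)

module _ {r r' : ℕ} {f : Fin r → ℕ} {f' : Fin r' → ℕ} where

  lowering-strictMono : Lowering f f' → f Preserves _<ᶠ_ ⟶ _<_ → f' Preserves _<ᶠ_ ⟶ _<_
  lowering-strictMono (hit _ f≡) mono a<b = s<s⁻¹ (subst₂ _<_ (f≡ _) (f≡ _) (mono (s<s a<b)))
  lowering-strictMono (miss f≡)  mono a<b = s<s⁻¹ (subst₂ _<_ (f≡ _) (f≡ _) (mono a<b))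

  lowering-bounded : Lowering f f' → (∀ a → f a < suc t) → ∀ a → f' a < t
  lowering-bounded (hit _ f≡) bound a = s<s⁻¹ (subst (_< _) (f≡ a) (bound (suc a)))
  lowering-bounded (miss f≡)  bound a = s<s⁻¹ (subst (_< _) (f≡ a) (bound a))

  lowering-preimage : Lowering f f' → ∀ {a v} → f a ≡ suc v → ∃ λ a' → f' a' ≡ v
  lowering-preimage (hit f0≡0 _) {zero} fa≡ = contradiction (trans (sym f0≡0) fa≡) 0≢1+n
  lowering-preimage (hit _ f≡) {suc a} fa≡ = a , suc-injective (trans (sym (f≡ a)) fa≡)
  lowering-preimage (miss f≡)  {a}     fa≡ = a , suc-injective (trans (sym (f≡ a)) fa≡)

record ShuffleData (t : ℕ) (fl : Fin r → ℕ) (fr : Fin s → ℕ) : Set where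
  field
    l-strictMono : fl Preserves _<ᶠ_ ⟶ _<_
    r-strictMono : fr Preserves _<ᶠ_ ⟶ _<_
    l-bounded    : ∀ a → fl a < t
    r-bounded    : ∀ b → fr b < t
    covers       : ∀ {v} → v < t → (∃ λ a → fl a ≡ v) ⊎ (∃ λ b → fr b ≡ v)

open ShuffleData

lowerShuffleData : ∀ {r' s'} {fl : Fin r → ℕ} {fr : Fin s → ℕ} {fl' : Fin r' → ℕ} {fr' : Fin s' → ℕ} →
                   ShuffleData (suc t) fl fr → Lowering fl fl' → Lowering fr fr' → ShuffleData t fl' fr'
lowerShuffleData d Ll Lr = record
  { l-strictMono = lowering-strictMono Ll (l-strictMono d)
  ; r-strictMono = lowering-strictMono Lr (r-strictMono d)
  ; l-bounded    = lowering-bounded Ll (l-bounded d)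
  ; r-bounded    = lowering-bounded Lr (r-bounded d)
  ; covers       = Sum.map (lowering-preimage Ll ∘ proj₂) (lowering-preimage Lr ∘ proj₂) ∘ covers d ∘ s<s
  }

Realises : Shuffle r s t → (Fin r → ℕ) → (Fin s → ℕ) → Set
Realises w fl fr = (∀ a → toℕ (lmap w a) ≡ fl a) × (∀ b → toℕ (rmap w b) ≡ fr b)

realise : ∀ {fl : Fin r → ℕ} {fr : Fin s → ℕ} → ShuffleData t fl fr →
          Σ (Shuffle r s t) λ w → Realises w fl fr
realise {zero}  {zero}  {zero} d = [] , (λ ()) , (λ ())
realise {suc r} {_}     {zero} d = ⊥-elim (n≮0 (l-bounded d zero))
realise {zero}  {suc s} {zero} d = ⊥-elim (n≮0 (r-bounded d zero))
realise {t = suc t} {fl} {fr} d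
  with lowering fl (l-strictMono d) | lowering fr (r-strictMono d)
... | _ , _ , Ll@(hit l0 l≡) | _ , _ , Lr@(hit r0 r≡) =
  let w , wl , wr = realise (lowerShuffleData d Ll Lr) in
  lr∷ w , (λ { zero → sym l0 ; (suc a) → trans (cong suc (wl a)) (sym (l≡ a)) })
        , (λ { zero → sym r0 ; (suc b) → trans (cong suc (wr b)) (sym (r≡ b)) })
... | _ , _ , Ll@(hit l0 l≡) | _ , _ , Lr@(miss r≡) =
  let w , wl , wr = realise (lowerShuffleData d Ll Lr) in
  l∷ w , (λ { zero → sym l0 ; (suc a) → trans (cong suc (wl a)) (sym (l≡ a)) })
       , (λ b → trans (cong suc (wr b)) (sym (r≡ b)))
... | _ , _ , Ll@(miss l≡) | _ , _ , Lr@(hit r0 r≡) =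
  let w , wl , wr = realise (lowerShuffleData d Ll Lr) in
  r∷ w , (λ a → trans (cong suc (wl a)) (sym (l≡ a)))
       , (λ { zero → sym r0 ; (suc b) → trans (cong suc (wr b)) (sym (r≡ b)) })
... | _ , _ , miss l≡ | _ , _ , miss r≡ with covers d z<s
...   | inj₁ (a , fa≡0) = contradiction (trans (sym (l≡ a)) fa≡0) λ ()
...   | inj₂ (b , fb≡0) = contradiction (trans (sym (r≡ b)) fb≡0) λ ()

toVec : Shuffle r s t → Vec (Fin t) (r + s)
toVec w = tabulate₂ (lmap w) (rmap w)

module _ (σ : Vec (Fin t) (suc r + suc s)) where

  shuffle-ShuffleData : Surj σ → IsShuffle r s (t , σ) →
                        ShuffleData t (λ a → toℕ (lookup σ (a ↑ˡ suc s))) (λ b → toℕ (lookup σ (suc r ↑ʳ b)))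
  shuffle-ShuffleData σ-surj (l-inc , r-inc) = record
    { l-strictMono = λ a<a' → subst₂ _<ᶠ_ (lookup-take (suc r) σ _) (lookup-take (suc r) σ _)
                                (increasing⇒lookup-strictMono _ l-inc a<a')
    ; r-strictMono = λ b<b' → subst₂ _<ᶠ_ (lookup-drop (suc r) σ _) (lookup-drop (suc r) σ _)
                                (increasing⇒lookup-strictMono _ r-inc b<b')
    ; l-bounded    = λ a → FinP.toℕ<n _
    ; r-bounded    = λ b → FinP.toℕ<n _
    ; covers       = λ v<t → go (splitView (suc r) (suc s) (section σ σ-surj (fromℕ< v<t)))
                                (trans (cong toℕ (lookup-section σ σ-surj _)) (FinP.toℕ-fromℕ< v<t))
    }
    where
    go : ∀ {p v} → SplitView (suc r) (suc s) p → toℕ (lookup σ p) ≡ v →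
         (∃ λ a → toℕ (lookup σ (a ↑ˡ suc s)) ≡ v) ⊎ (∃ λ b → toℕ (lookup σ (suc r ↑ʳ b)) ≡ v)
    go (inl a) σp≡v = inj₁ (a , σp≡v)
    go (inr b) σp≡v = inj₂ (b , σp≡v)

  shuffle⇒toVec : Surj σ → IsShuffle r s (t , σ) → Σ (Shuffle (suc r) (suc s) t) λ w → toVec w ≡ σ
  shuffle⇒toVec σ-surj σ-shuffle with realise (shuffle-ShuffleData σ-surj σ-shuffle)
  ... | w , wl , wr =
    w , ++-ext (λ a → trans (lookup-tabulate₂-↑ˡ (lmap w) (rmap w) a) (FinP.toℕ-injective (wl a)))
               (λ b → trans (lookup-tabulate₂-↑ʳ (lmap w) (rmap w) b) (FinP.toℕ-injective (wr b)))

-- The weak order on words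

data Orientation : Set where
  left-first right-first : Orientation

-- Fusion o i big small: the values i and i+1 of big, one hit only by the first block and the
-- other only by the second (in the order given by o), become the single value i of small.
data Fusion : Orientation → Fin (suc k) → Shuffle r s (suc (suc k)) → Shuffle r s (suc k) → Set where
  fuse-lr    : (w : Shuffle r s t) → Fusion left-first zero (l∷ r∷ w) (lr∷ w)
  fuse-rl    : (w : Shuffle r s t) → Fusion right-first zero (r∷ l∷ w) (lr∷ w)
  l∷-fusion  : ∀ {o i} {big : Shuffle r s (suc (suc k))} {small} →
               Fusion o i big small → Fusion o (suc i) (l∷ big) (l∷ small)
  r∷-fusion  : ∀ {o i} {big : Shuffle r s (suc (suc k))} {small} →
               Fusion o i big small → Fusion o (suc i) (r∷ big) (r∷ small)
  lr∷-fusion : ∀ {o i} {big : Shuffle r s (suc (suc k))} {small} →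
               Fusion o i big small → Fusion o (suc i) (lr∷ big) (lr∷ small)

fusion-lmap : ∀ {o i} {big : Shuffle r s (suc (suc k))} {small} →
              Fusion o i big small → ∀ a → lmap small a ≡ tmap i (lmap big a)
fusion-lmap (fuse-lr w)    zero    = refl
fusion-lmap (fuse-lr w)    (suc a) = refl
fusion-lmap (fuse-rl w)    zero    = refl
fusion-lmap (fuse-rl w)    (suc a) = refl
fusion-lmap (l∷-fusion f)  zero    = refl
fusion-lmap (l∷-fusion f)  (suc a) = cong suc (fusion-lmap f a)
fusion-lmap (r∷-fusion f)  a       = cong suc (fusion-lmap f a)
fusion-lmap (lr∷-fusion f) zero    = refl
fusion-lmap (lr∷-fusion f) (suc a) = cong suc (fusion-lmap f a)

fusion-rmap : ∀ {o i} {big : Shuffle r s (suc (suc k))} {small} →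
              Fusion o i big small → ∀ b → rmap small b ≡ tmap i (rmap big b)
fusion-rmap (fuse-lr w)    zero    = refl
fusion-rmap (fuse-lr w)    (suc b) = refl
fusion-rmap (fuse-rl w)    zero    = refl
fusion-rmap (fuse-rl w)    (suc b) = refl
fusion-rmap (l∷-fusion f)  b       = cong suc (fusion-rmap f b)
fusion-rmap (r∷-fusion f)  zero    = refl
fusion-rmap (r∷-fusion f)  (suc b) = cong suc (fusion-rmap f b)
fusion-rmap (lr∷-fusion f) zero    = refl
fusion-rmap (lr∷-fusion f) (suc b) = cong suc (fusion-rmap f b)

Avoids : Fin t → (Fin k → Fin t) → Set
Avoids j f = ∀ x → f x ≢ j

Separated : Orientation → Shuffle r s (suc (suc k)) → Fin (suc k) → Set
Separated left-first  w i = Avoids (inject₁ i) (rmap w) × Avoids (suc i) (lmap w)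
Separated right-first w i = Avoids (inject₁ i) (lmap w) × Avoids (suc i) (rmap w)

avoids-suc : ∀ {j : Fin t} {f : Fin k → Fin t} → Avoids j f → Avoids (suc j) (suc ∘ f)
avoids-suc avoid x = avoid x ∘ FinP.suc-injective

avoids-zero-suc : ∀ {j : Fin t} {f : Fin k → Fin t} (g : Fin (suc k) → Fin (suc t)) →
                  g zero ≡ zero → (∀ x → g (suc x) ≡ suc (f x)) → Avoids j f → Avoids (suc j) g
avoids-zero-suc g g0 gs avoid zero    e = 0≢1+n (cong toℕ (trans (sym g0) e))
avoids-zero-suc g g0 gs avoid (suc x) e = avoid x (FinP.suc-injective (trans (sym (gs x)) e))

separated-∷ : ∀ o {i : Fin (suc k)} {w : Shuffle r s (suc (suc k))}
              {r' s'} {w' : Shuffle r' s' (suc (suc (suc k)))} →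
              (∀ {j} → Avoids j (lmap w) → Avoids (suc j) (lmap w')) →
              (∀ {j} → Avoids j (rmap w) → Avoids (suc j) (rmap w')) →
              Separated o w i → Separated o w' (suc i)
separated-∷ left-first  onL onR (avoidR , avoidL) = onR avoidR , onL avoidL
separated-∷ right-first onL onR (avoidL , avoidR) = onL avoidL , onR avoidR

fusion-separated : ∀ {o i} {big : Shuffle r s (suc (suc k))} {small} →
                   Fusion o i big small → Separated o big i
fusion-separated (fuse-lr w) = (λ _ ()) , λ { zero () ; (suc _) () }
fusion-separated (fuse-rl w) = (λ _ ()) , λ { zero () ; (suc _) () }
fusion-separated (l∷-fusion {big = big} f) =
  separated-∷ _ (avoids-zero-suc (lmap (l∷ big)) refl (λ _ → refl)) avoids-suc (fusion-separated f)
fusion-separated (r∷-fusion {big = big} f) =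
  separated-∷ _ avoids-suc (avoids-zero-suc (rmap (r∷ big)) refl (λ _ → refl)) (fusion-separated f)
fusion-separated (lr∷-fusion {big = big} f) =
  separated-∷ _ (avoids-zero-suc (lmap (lr∷ big)) refl (λ _ → refl))
                (avoids-zero-suc (rmap (lr∷ big)) refl (λ _ → refl)) (fusion-separated f)

Shuffles : ℕ → ℕ → Set
Shuffles r s = Σ ℕ (Shuffle r s)

-- Merging a left-first pair goes up in the weak order, so splitting a value into a
-- right-first pair does too.
data _⇝_ : Shuffles r s → Shuffles r s → Set where
  merge : ∀ {i} {big : Shuffle r s (suc (suc k))} {small} →
          Fusion left-first i big small → (_ , big) ⇝ (_ , small)
  split : ∀ {i} {big : Shuffle r s (suc (suc k))} {small} →
          Fusion right-first i big small → (_ , small) ⇝ (_ , big)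

_≤ˢ_ : Shuffles r s → Shuffles r s → Set
_≤ˢ_ = Star _⇝_

≤ˢ-map : ∀ {r' s'} (F : ∀ {t} → Shuffle r s t → Shuffle r' s' (suc t)) →
         (∀ {o k i} {big : Shuffle r s (suc (suc k))} {small} →
            Fusion o i big small → ∃ λ j → Fusion o j (F big) (F small)) →
         ∀ {x y} → x ≤ˢ y → Product.map suc F x ≤ˢ Product.map suc F y
≤ˢ-map F F-fusion = gmap (Product.map suc F) λ where
  (merge f) → merge (proj₂ (F-fusion f))
  (split f) → split (proj₂ (F-fusion f))

l∷-mono : ∀ {x y : Shuffles r s} → x ≤ˢ y → Product.map suc l∷_ x ≤ˢ Product.map suc l∷_ y
l∷-mono = ≤ˢ-map l∷_ λ f → _ , l∷-fusion f

r∷-mono : ∀ {x y : Shuffles r s} → x ≤ˢ y → Product.map suc r∷_ x ≤ˢ Product.map suc r∷_ y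
r∷-mono = ≤ˢ-map r∷_ λ f → _ , r∷-fusion f

lr∷-mono : ∀ {x y : Shuffles r s} → x ≤ˢ y → Product.map suc lr∷_ x ≤ˢ Product.map suc lr∷_ y
lr∷-mono = ≤ˢ-map lr∷_ λ f → _ , lr∷-fusion f

-- The first block entirely below the second: the shuffle of γ × δ itself.
bottom : ∀ r s → Shuffle r s (r + s)
bottom zero    zero    = []
bottom zero    (suc s) = r∷ bottom zero s
bottom (suc r) s       = l∷ bottom r s

-- The second block entirely below the first: ξ_{r,s}.
top : ∀ r s → Shuffle r s (s + r)
top r       (suc s) = r∷ top r s
top zero    zero    = []
top (suc r) zero    = l∷ top r zero

bottom-≤ˢ-r∷ : ∀ r s → (_ , bottom r (suc s)) ≤ˢ (_ , r∷ bottom r s)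
bottom-≤ˢ-r∷ zero    s = ε
bottom-≤ˢ-r∷ (suc r) s =
  l∷-mono (bottom-≤ˢ-r∷ r s) ◅◅ merge (fuse-lr (bottom r s)) ◅ split (fuse-rl (bottom r s)) ◅ ε

bottom-≤ˢ : (w : Shuffle r s t) → (_ , bottom r s) ≤ˢ (_ , w)
bottom-≤ˢ []       = ε
bottom-≤ˢ (l∷ w)  = l∷-mono (bottom-≤ˢ w)
bottom-≤ˢ {zero}  (r∷ w) = r∷-mono (bottom-≤ˢ w)
bottom-≤ˢ {suc r} (r∷ w) = bottom-≤ˢ-r∷ (suc r) _ ◅◅ r∷-mono (bottom-≤ˢ w)
bottom-≤ˢ (lr∷ w) =
  l∷-mono (bottom-≤ˢ-r∷ _ _) ◅◅ merge (fuse-lr (bottom _ _)) ◅ lr∷-mono (bottom-≤ˢ w)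

l∷-top-≤ˢ : ∀ r s → (_ , l∷ top r s) ≤ˢ (_ , top (suc r) s)
l∷-top-≤ˢ r zero    = ε
l∷-top-≤ˢ r (suc s) =
  merge (fuse-lr (top r s)) ◅ split (fuse-rl (top r s)) ◅ r∷-mono (l∷-top-≤ˢ r s)

≤ˢ-top : (w : Shuffle r s t) → (_ , w) ≤ˢ (_ , top r s)
≤ˢ-top []      = ε
≤ˢ-top (l∷ w)  = l∷-mono (≤ˢ-top w) ◅◅ l∷-top-≤ˢ _ _
≤ˢ-top (r∷ w)  = r∷-mono (≤ˢ-top w)
≤ˢ-top (lr∷ w) = lr∷-mono (≤ˢ-top w) ◅◅ split (fuse-rl (top _ _)) ◅ r∷-mono (l∷-top-≤ˢ _ _)

_∷l : Shuffle r s t → Shuffle (suc r) s (suc t)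
[]       ∷l = l∷ []
(l∷ w)  ∷l = l∷ (w ∷l)
(r∷ w)  ∷l = r∷ (w ∷l)
(lr∷ w) ∷l = lr∷ (w ∷l)

_∷r : Shuffle r s t → Shuffle r (suc s) (suc t)
[]       ∷r = r∷ []
(l∷ w)  ∷r = l∷ (w ∷r)
(r∷ w)  ∷r = r∷ (w ∷r)
(lr∷ w) ∷r = lr∷ (w ∷r)

_∷lr : Shuffle r s t → Shuffle (suc r) (suc s) (suc t)
[]       ∷lr = lr∷ []
(l∷ w)  ∷lr = l∷ (w ∷lr)
(r∷ w)  ∷lr = r∷ (w ∷lr)
(lr∷ w) ∷lr = lr∷ (w ∷lr)

data SnocView : Shuffle r s t → Set where
  []     : SnocView []
  ends-l  : (u : Shuffle r s t) → SnocView (u ∷l)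
  ends-r  : (u : Shuffle r s t) → SnocView (u ∷r)
  ends-lr : (u : Shuffle r s t) → SnocView (u ∷lr)

snocView : (w : Shuffle r s t) → SnocView w
snocView [] = []
snocView (l∷ w) with snocView w
... | []        = ends-l []
... | ends-l u  = ends-l (l∷ u)
... | ends-r u  = ends-r (l∷ u)
... | ends-lr u = ends-lr (l∷ u)
snocView (r∷ w) with snocView w
... | []        = ends-r []
... | ends-l u  = ends-l (r∷ u)
... | ends-r u  = ends-r (r∷ u)
... | ends-lr u = ends-lr (r∷ u)
snocView (lr∷ w) with snocView w
... | []        = ends-lr []
... | ends-l u  = ends-l (lr∷ u)
... | ends-r u  = ends-r (lr∷ u)
... | ends-lr u = ends-lr (lr∷ u)

∷l-fusion : ∀ {o i} {big : Shuffle r s (suc (suc k))} {small} →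
            Fusion o i big small → Fusion o (inject₁ i) (big ∷l) (small ∷l)
∷l-fusion (fuse-lr w)    = fuse-lr (w ∷l)
∷l-fusion (fuse-rl w)    = fuse-rl (w ∷l)
∷l-fusion (l∷-fusion f)  = l∷-fusion (∷l-fusion f)
∷l-fusion (r∷-fusion f)  = r∷-fusion (∷l-fusion f)
∷l-fusion (lr∷-fusion f) = lr∷-fusion (∷l-fusion f)

∷r-fusion : ∀ {o i} {big : Shuffle r s (suc (suc k))} {small} →
            Fusion o i big small → Fusion o (inject₁ i) (big ∷r) (small ∷r)
∷r-fusion (fuse-lr w)    = fuse-lr (w ∷r)
∷r-fusion (fuse-rl w)    = fuse-rl (w ∷r)
∷r-fusion (l∷-fusion f)  = l∷-fusion (∷r-fusion f)
∷r-fusion (r∷-fusion f)  = r∷-fusion (∷r-fusion f)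
∷r-fusion (lr∷-fusion f) = lr∷-fusion (∷r-fusion f)

∷lr-fusion : ∀ {o i} {big : Shuffle r s (suc (suc k))} {small} →
             Fusion o i big small → Fusion o (inject₁ i) (big ∷lr) (small ∷lr)
∷lr-fusion (fuse-lr w)    = fuse-lr (w ∷lr)
∷lr-fusion (fuse-rl w)    = fuse-rl (w ∷lr)
∷lr-fusion (l∷-fusion f)  = l∷-fusion (∷lr-fusion f)
∷lr-fusion (r∷-fusion f)  = r∷-fusion (∷lr-fusion f)
∷lr-fusion (lr∷-fusion f) = lr∷-fusion (∷lr-fusion f)

∷l-mono : ∀ {x y : Shuffles r s} → x ≤ˢ y → Product.map suc _∷l x ≤ˢ Product.map suc _∷l y
∷l-mono = ≤ˢ-map _∷l λ f → _ , ∷l-fusion f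

∷r-mono : ∀ {x y : Shuffles r s} → x ≤ˢ y → Product.map suc _∷r x ≤ˢ Product.map suc _∷r y
∷r-mono = ≤ˢ-map _∷r λ f → _ , ∷r-fusion f

∷lr-mono : ∀ {x y : Shuffles r s} → x ≤ˢ y → Product.map suc _∷lr x ≤ˢ Product.map suc _∷lr y
∷lr-mono = ≤ˢ-map _∷lr λ f → _ , ∷lr-fusion f

toℕ-lmap-∷l-inject₁ : (w : Shuffle r s t) (a : Fin r) → toℕ (lmap (w ∷l) (inject₁ a)) ≡ toℕ (lmap w a)
toℕ-lmap-∷l-inject₁ (l∷ w)  zero    = refl
toℕ-lmap-∷l-inject₁ (l∷ w)  (suc a) = cong suc (toℕ-lmap-∷l-inject₁ w a)
toℕ-lmap-∷l-inject₁ (r∷ w)  a       = cong suc (toℕ-lmap-∷l-inject₁ w a)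
toℕ-lmap-∷l-inject₁ (lr∷ w) zero    = refl
toℕ-lmap-∷l-inject₁ (lr∷ w) (suc a) = cong suc (toℕ-lmap-∷l-inject₁ w a)

toℕ-lmap-∷l-last : (w : Shuffle r s t) → toℕ (lmap (w ∷l) (fromℕ r)) ≡ t
toℕ-lmap-∷l-last []      = refl
toℕ-lmap-∷l-last (l∷ w)  = cong suc (toℕ-lmap-∷l-last w)
toℕ-lmap-∷l-last (r∷ w)  = cong suc (toℕ-lmap-∷l-last w)
toℕ-lmap-∷l-last (lr∷ w) = cong suc (toℕ-lmap-∷l-last w)

toℕ-rmap-∷l : (w : Shuffle r s t) (b : Fin s) → toℕ (rmap (w ∷l) b) ≡ toℕ (rmap w b)
toℕ-rmap-∷l (l∷ w)  b       = cong suc (toℕ-rmap-∷l w b)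
toℕ-rmap-∷l (r∷ w)  zero    = refl
toℕ-rmap-∷l (r∷ w)  (suc b) = cong suc (toℕ-rmap-∷l w b)
toℕ-rmap-∷l (lr∷ w) zero    = refl
toℕ-rmap-∷l (lr∷ w) (suc b) = cong suc (toℕ-rmap-∷l w b)

toℕ-lmap-∷r : (w : Shuffle r s t) (a : Fin r) → toℕ (lmap (w ∷r) a) ≡ toℕ (lmap w a)
toℕ-lmap-∷r (l∷ w)  zero    = refl
toℕ-lmap-∷r (l∷ w)  (suc a) = cong suc (toℕ-lmap-∷r w a)
toℕ-lmap-∷r (r∷ w)  a       = cong suc (toℕ-lmap-∷r w a)
toℕ-lmap-∷r (lr∷ w) zero    = refl
toℕ-lmap-∷r (lr∷ w) (suc a) = cong suc (toℕ-lmap-∷r w a)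

toℕ-rmap-∷r-inject₁ : (w : Shuffle r s t) (b : Fin s) → toℕ (rmap (w ∷r) (inject₁ b)) ≡ toℕ (rmap w b)
toℕ-rmap-∷r-inject₁ (l∷ w)  b       = cong suc (toℕ-rmap-∷r-inject₁ w b)
toℕ-rmap-∷r-inject₁ (r∷ w)  zero    = refl
toℕ-rmap-∷r-inject₁ (r∷ w)  (suc b) = cong suc (toℕ-rmap-∷r-inject₁ w b)
toℕ-rmap-∷r-inject₁ (lr∷ w) zero    = refl
toℕ-rmap-∷r-inject₁ (lr∷ w) (suc b) = cong suc (toℕ-rmap-∷r-inject₁ w b)

toℕ-rmap-∷r-last : (w : Shuffle r s t) → toℕ (rmap (w ∷r) (fromℕ s)) ≡ t
toℕ-rmap-∷r-last []      = refl
toℕ-rmap-∷r-last (l∷ w)  = cong suc (toℕ-rmap-∷r-last w)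
toℕ-rmap-∷r-last (r∷ w)  = cong suc (toℕ-rmap-∷r-last w)
toℕ-rmap-∷r-last (lr∷ w) = cong suc (toℕ-rmap-∷r-last w)

toℕ-lmap-∷lr-inject₁ : (w : Shuffle r s t) (a : Fin r) → toℕ (lmap (w ∷lr) (inject₁ a)) ≡ toℕ (lmap w a)
toℕ-lmap-∷lr-inject₁ (l∷ w)  zero    = refl
toℕ-lmap-∷lr-inject₁ (l∷ w)  (suc a) = cong suc (toℕ-lmap-∷lr-inject₁ w a)
toℕ-lmap-∷lr-inject₁ (r∷ w)  a       = cong suc (toℕ-lmap-∷lr-inject₁ w a)
toℕ-lmap-∷lr-inject₁ (lr∷ w) zero    = refl
toℕ-lmap-∷lr-inject₁ (lr∷ w) (suc a) = cong suc (toℕ-lmap-∷lr-inject₁ w a)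

toℕ-lmap-∷lr-last : (w : Shuffle r s t) → toℕ (lmap (w ∷lr) (fromℕ r)) ≡ t
toℕ-lmap-∷lr-last []      = refl
toℕ-lmap-∷lr-last (l∷ w)  = cong suc (toℕ-lmap-∷lr-last w)
toℕ-lmap-∷lr-last (r∷ w)  = cong suc (toℕ-lmap-∷lr-last w)
toℕ-lmap-∷lr-last (lr∷ w) = cong suc (toℕ-lmap-∷lr-last w)

toℕ-rmap-∷lr-inject₁ : (w : Shuffle r s t) (b : Fin s) → toℕ (rmap (w ∷lr) (inject₁ b)) ≡ toℕ (rmap w b)
toℕ-rmap-∷lr-inject₁ (l∷ w)  b       = cong suc (toℕ-rmap-∷lr-inject₁ w b)
toℕ-rmap-∷lr-inject₁ (r∷ w)  zero    = refl
toℕ-rmap-∷lr-inject₁ (r∷ w)  (suc b) = cong suc (toℕ-rmap-∷lr-inject₁ w b)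
toℕ-rmap-∷lr-inject₁ (lr∷ w) zero    = refl
toℕ-rmap-∷lr-inject₁ (lr∷ w) (suc b) = cong suc (toℕ-rmap-∷lr-inject₁ w b)

toℕ-rmap-∷lr-last : (w : Shuffle r s t) → toℕ (rmap (w ∷lr) (fromℕ s)) ≡ t
toℕ-rmap-∷lr-last []      = refl
toℕ-rmap-∷lr-last (l∷ w)  = cong suc (toℕ-rmap-∷lr-last w)
toℕ-rmap-∷lr-last (r∷ w)  = cong suc (toℕ-rmap-∷lr-last w)
toℕ-rmap-∷lr-last (lr∷ w) = cong suc (toℕ-rmap-∷lr-last w)

lastCmp : Shuffle (suc r) (suc s) t → ℕ
lastCmp {r} {s} w = cmpᶠ (lmap w (fromℕ r)) (rmap w (fromℕ s))

lastCmp-∷r : (u : Shuffle (suc r) s t) → lastCmp (u ∷r) ≡ 0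
lastCmp-∷r u = cmpCode-< (subst₂ _<_ (sym (toℕ-lmap-∷r u _)) (sym (toℕ-rmap-∷r-last u)) (FinP.toℕ<n _))

lastCmp-∷lr : (u : Shuffle r s t) → lastCmp (u ∷lr) ≡ 1
lastCmp-∷lr u = cmpCode-≡ (trans (toℕ-lmap-∷lr-last u) (sym (toℕ-rmap-∷lr-last u)))

lastCmp-∷l : (u : Shuffle r (suc s) t) → lastCmp (u ∷l) ≡ 2
lastCmp-∷l u = cmpCode-> (subst₂ _<_ (sym (toℕ-rmap-∷l u _)) (sym (toℕ-lmap-∷l-last u)) (FinP.toℕ<n _))

lastCmp≡0⇒≤ˢ-top∷r : (w : Shuffle (suc r) (suc s) t) → lastCmp w ≡ 0 →
                     (_ , w) ≤ˢ (_ , top (suc r) s ∷r)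
lastCmp≡0⇒≤ˢ-top∷r w c≡0 with snocView w
... | ends-r u  = ∷r-mono (≤ˢ-top u)
... | ends-l u  = contradiction (trans (sym c≡0) (lastCmp-∷l u)) λ ()
... | ends-lr u = contradiction (trans (sym c≡0) (lastCmp-∷lr u)) λ ()

lastCmp≡1⇒∈[bottom∷lr,top∷lr] : (w : Shuffle (suc r) (suc s) t) → lastCmp w ≡ 1 →
  (_ , bottom r s ∷lr) ≤ˢ (_ , w) × (_ , w) ≤ˢ (_ , top r s ∷lr)
lastCmp≡1⇒∈[bottom∷lr,top∷lr] w c≡1 with snocView w
... | ends-lr u = ∷lr-mono (bottom-≤ˢ u) , ∷lr-mono (≤ˢ-top u)
... | ends-r u  = contradiction (trans (sym c≡1) (lastCmp-∷r u)) λ ()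
... | ends-l u  = contradiction (trans (sym c≡1) (lastCmp-∷l u)) λ ()

lastCmp≡2⇒bottom∷l-≤ˢ : (w : Shuffle (suc r) (suc s) t) → lastCmp w ≡ 2 →
                        (_ , bottom r (suc s) ∷l) ≤ˢ (_ , w)
lastCmp≡2⇒bottom∷l-≤ˢ w c≡2 with snocView w
... | ends-l u  = ∷l-mono (bottom-≤ˢ u)
... | ends-r u  = contradiction (trans (sym c≡2) (lastCmp-∷r u)) λ ()
... | ends-lr u = contradiction (trans (sym c≡2) (lastCmp-∷lr u)) λ ()

toℕ-lmap-bottom : ∀ r s (a : Fin r) → toℕ (lmap (bottom r s) a) ≡ toℕ a
toℕ-lmap-bottom (suc r) s zero    = refl
toℕ-lmap-bottom (suc r) s (suc a) = cong suc (toℕ-lmap-bottom r s a)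

toℕ-rmap-bottom : ∀ r s (b : Fin s) → toℕ (rmap (bottom r s) b) ≡ r + toℕ b
toℕ-rmap-bottom zero    (suc s) zero    = refl
toℕ-rmap-bottom zero    (suc s) (suc b) = cong suc (toℕ-rmap-bottom zero s b)
toℕ-rmap-bottom (suc r) s       b       = cong suc (toℕ-rmap-bottom r s b)

toℕ-lmap-top : ∀ r s (a : Fin r) → toℕ (lmap (top r s) a) ≡ s + toℕ a
toℕ-lmap-top r       (suc s) a       = cong suc (toℕ-lmap-top r s a)
toℕ-lmap-top (suc r) zero    zero    = refl
toℕ-lmap-top (suc r) zero    (suc a) = cong suc (toℕ-lmap-top r zero a)

toℕ-rmap-top : ∀ r s (b : Fin s) → toℕ (rmap (top r s) b) ≡ toℕ b
toℕ-rmap-top r (suc s) zero    = refl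
toℕ-rmap-top r (suc s) (suc b) = cong suc (toℕ-rmap-top r s b)

lastCmp-bottom : ∀ r s → lastCmp (bottom (suc r) (suc s)) ≡ 0
lastCmp-bottom r s = cmpCode-< (subst₂ _<_
  (sym (trans (toℕ-lmap-bottom (suc r) (suc s) (fromℕ r)) (FinP.toℕ-fromℕ r)))
  (sym (trans (toℕ-rmap-bottom (suc r) (suc s) (fromℕ s)) (cong (suc r +_) (FinP.toℕ-fromℕ s))))
  (s≤s (m≤m+n r s)))

lastCmp-top : ∀ r s → lastCmp (top (suc r) (suc s)) ≡ 2
lastCmp-top r s = cmpCode-> (subst₂ _<_
  (sym (trans (toℕ-rmap-top (suc r) (suc s) (fromℕ s)) (FinP.toℕ-fromℕ s)))
  (sym (trans (toℕ-lmap-top (suc r) (suc s) (fromℕ r)) (cong (suc s +_) (FinP.toℕ-fromℕ r))))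
  (s≤s (m≤m+n s r)))

-- Formal sums

concatMap-unique : ∀ {A B : Set} {f : A → List B} (tag : B → A) →
                   (∀ {x y} → y ∈ₗ f x → tag y ≡ x) → (∀ x → Unique (f x)) →
                   ∀ {xs} → Unique xs → Unique (concatMap f xs)
concatMap-unique tag tagged f-unique xs-unique = UniqueP.concat⁺
  (AllP.map⁺ (All.universal f-unique _))
  (AllPairsP.map⁺ (AllPairs.map
    (λ x≢x' {_} (y∈fx , y∈fx') → x≢x' (trans (sym (tagged y∈fx)) (tagged y∈fx'))) xs-unique))

allVecs-unique : ∀ t N → Unique (allVecs t N)
allVecs-unique t zero    = [] ∷ []
allVecs-unique t (suc N) = concatMap-unique Vec.head
  (λ {x} y∈ → case ∈-map⁻ (x ∷_) y∈ of λ { (_ , _ , refl) → refl })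
  (λ x → UniqueP.map⁺ (proj₂ ∘ VecP.∷-injective) (allVecs-unique t N)) (UniqueP.allFin⁺ t)

allVecs-complete : (v : Vec (Fin t) N) → v ∈ₗ allVecs t N
allVecs-complete []      = here refl
allVecs-complete {t} {suc N} (x ∷ v) = ∈-concatMap⁺ (λ x → List.map (x ∷_) (allVecs t N))
  (AnyL.map (λ { refl → ∈-map⁺ (x ∷_) (allVecs-complete v) }) (∈-allFin x))

allP-unique : ∀ N → Unique (allP N)
allP-unique N = UniqueP.filter⁺ (surj? ∘ proj₂) (concatMap-unique proj₁
  (λ {t} y∈ → case ∈-map⁻ (t ,_) y∈ of λ { (_ , _ , refl) → refl })
  (λ t → UniqueP.map⁺ (λ { refl → refl }) (allVecs-unique t N)) (UniqueP.upTo⁺ (suc N)))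

∈-allP : (v : Vec (Fin t) N) → Surj v → (t , v) ∈ₗ allP N
∈-allP {t} {N} v v-surj = ∈-filter⁺ (surj? ∘ proj₂)
  (∈-concatMap⁺ (λ t → List.map (t ,_) (allVecs t N))
    (AnyL.map (λ { refl → ∈-map⁺ (_ ,_) (allVecs-complete v) }) (∈-upTo⁺ (s≤s (surj⇒≤ v v-surj)))))
  v-surj

∈-allP⁻ : ∀ {o : Obj N} → o ∈ₗ allP N → Surj (proj₂ o)
∈-allP⁻ {N} o∈ =
  proj₂ (∈-filter⁻ (surj? ∘ proj₂)
    {xs = concatMap (λ t → List.map (t ,_) (allVecs t N)) (List.upTo (suc N))} o∈)

module _ {c ℓ} (K : Field c ℓ) where
  open Field K using (_≈_; 0#; 1#; +-congˡ)
    renaming (refl to ≈-refl; trans to ≈-trans; +-identityʳ to +-identityʳ-≈)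

  coeff-∉ : ∀ xs {τ} → τ ∉ₗ xs → coeff K xs τ ≈ 0#
  coeff-∉ []       _   = ≈-refl
  coeff-∉ (x ∷ xs) {τ} τ∉ with x ≟B τ
  ... | yes x≡τ = contradiction (here (sym x≡τ)) τ∉
  ... | no _    = coeff-∉ xs (τ∉ ∘ there)

  coeff-∈ : ∀ {xs τ} → Unique xs → τ ∈ₗ xs → coeff K xs τ ≈ 1#
  coeff-∈ {x ∷ xs} {τ} (x∉xs ∷ xs-unique) τ∈ with x ≟B τ | τ∈
  ... | yes refl | _         =
    ≈-trans (+-congˡ (coeff-∉ xs (λ x∈ → All.lookup x∉xs x∈ refl))) (+-identityʳ-≈ 1#)
  ... | no x≢τ   | here τ≡x  = contradiction (sym τ≡x) x≢τ
  ... | no _     | there τ∈′ = coeff-∈ xs-unique τ∈′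

  coeff-≐Σ : ∀ {xs} {S : Basis → Set} → Unique xs → (∀ {τ} → InP∞ τ → S τ → τ ∈ₗ xs) →
             (∀ {τ} → τ ∈ₗ xs → S τ) → _≐Σ_ {k = K} (coeff K xs) S
  coeff-≐Σ xs-unique complete sound τ τ∈P =
    (λ Sτ → coeff-∈ xs-unique (complete τ∈P Sτ)) , (λ ¬Sτ → coeff-∉ _ (¬Sτ ∘ sound))

-- The product of γ and δ

toℕ-lookup-ξ-↑ˡ : ∀ a b (i : Fin a) → toℕ (lookup (ξ a b) (i ↑ˡ b)) ≡ b + toℕ i
toℕ-lookup-ξ-↑ˡ a b i = begin
  toℕ (lookup (ξ a b) (i ↑ˡ b))         ≡⟨ cong toℕ (lookup-map-++ˡ _ _ (allFin a) (allFin b) i) ⟩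
  toℕ (cast _ (b ↑ʳ lookup (allFin a) i)) ≡⟨ FinP.toℕ-cast _ _ ⟩
  toℕ (b ↑ʳ lookup (allFin a) i)          ≡⟨ FinP.toℕ-↑ʳ b _ ⟩
  b + toℕ (lookup (allFin a) i)           ≡⟨ cong (λ j → b + toℕ j) (VecP.lookup-allFin i) ⟩
  b + toℕ i                               ∎
  where open ≡-Reasoning

toℕ-lookup-ξ-↑ʳ : ∀ a b (j : Fin b) → toℕ (lookup (ξ a b) (a ↑ʳ j)) ≡ toℕ j
toℕ-lookup-ξ-↑ʳ a b j = begin
  toℕ (lookup (ξ a b) (a ↑ʳ j))           ≡⟨ cong toℕ (lookup-map-++ʳ _ _ (allFin a) (allFin b) j) ⟩
  toℕ (cast _ (lookup (allFin b) j ↑ˡ a)) ≡⟨ FinP.toℕ-cast _ _ ⟩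
  toℕ (lookup (allFin b) j ↑ˡ a)          ≡⟨ FinP.toℕ-↑ˡ _ a ⟩
  toℕ (lookup (allFin b) j)               ≡⟨ cong toℕ (VecP.lookup-allFin j) ⟩
  toℕ j                                   ∎
  where open ≡-Reasoning

module _ {a b c d : ℕ} (u : Vec (Fin a) b) (v : Vec (Fin c) d) where

  toℕ-lookup-⊠-↑ˡ : ∀ i → toℕ (lookup (u ⊠ v) (i ↑ˡ d)) ≡ toℕ (lookup u i)
  toℕ-lookup-⊠-↑ˡ i = trans (cong toℕ (lookup-map-++ˡ _ _ u v i)) (FinP.toℕ-↑ˡ _ c)

  toℕ-lookup-⊠-↑ʳ : ∀ j → toℕ (lookup (u ⊠ v) (b ↑ʳ j)) ≡ a + toℕ (lookup v j)
  toℕ-lookup-⊠-↑ʳ j = trans (cong toℕ (lookup-map-++ʳ _ _ u v j)) (FinP.toℕ-↑ʳ a _)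

lookup-cast : ∀ {A : Set} {m n} (xs : Vec A n) .(e : m ≡ n) {i : Fin m} {j : Fin n} →
              toℕ i ≡ toℕ j → lookup xs (cast e i) ≡ lookup xs j
lookup-cast xs e {i} i≡j = cong (lookup xs) (FinP.toℕ-injective (trans (FinP.toℕ-cast e i) i≡j))

-- allFin a ⊠ (u ∷ v), the shape of z(a,b) and z(a,b,0), read on Fin (suc a + n).
module _ (a : ℕ) {c n : ℕ} (u : Fin c) (v : Vec (Fin c) n) .(e : suc a + n ≡ a + suc n) where

  private
    V : Vec (Fin (a + c)) (a + suc n)
    V = allFin a ⊠ (u ∷ v)

  lookup-allFin⊠∷-inject₁ : ∀ i → lookup V (cast e (inject₁ i ↑ˡ n)) ≡ i ↑ˡ c
  lookup-allFin⊠∷-inject₁ i = begin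
    lookup V (cast e (inject₁ i ↑ˡ n)) ≡⟨ lookup-cast V e (trans (FinP.toℕ-↑ˡ (inject₁ i) n)
                                            (trans (FinP.toℕ-inject₁ i) (sym (FinP.toℕ-↑ˡ i (suc n))))) ⟩
    lookup V (i ↑ˡ suc n)              ≡⟨ lookup-map-++ˡ _ _ (allFin a) (u ∷ v) i ⟩
    lookup (allFin a) i ↑ˡ c           ≡⟨ cong (_↑ˡ c) (VecP.lookup-allFin i) ⟩
    i ↑ˡ c                             ∎
    where open ≡-Reasoning

  lookup-allFin⊠∷-last : lookup V (cast e (fromℕ a ↑ˡ n)) ≡ a ↑ʳ u
  lookup-allFin⊠∷-last = trans
    (lookup-cast V e (trans (FinP.toℕ-↑ˡ (fromℕ a) n)
      (trans (FinP.toℕ-fromℕ a) (sym (trans (FinP.toℕ-↑ʳ a zero) (+-identityʳ a))))))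
    (lookup-map-++ʳ _ _ (allFin a) (u ∷ v) zero)

  lookup-allFin⊠∷-↑ʳ : ∀ j → lookup V (cast e (suc a ↑ʳ j)) ≡ a ↑ʳ lookup v j
  lookup-allFin⊠∷-↑ʳ j = trans
    (lookup-cast V e (trans (FinP.toℕ-↑ʳ (suc a) j) (sym (trans (FinP.toℕ-↑ʳ a (suc j)) (+-suc a _)))))
    (lookup-map-++ʳ _ _ (allFin a) (u ∷ v) (suc j))

module _ (a b : ℕ) .(e : a + suc b ≡ (a + b) + 1) where

  private
    V : Vec (Fin ((a + b) + 1)) ((a + b) + 1)
    V = ξ a b ⊠ one₁

  toℕ-ξ⊠one₁-↑ˡ : ∀ i → toℕ (lookup V (cast e (i ↑ˡ suc b))) ≡ b + toℕ i
  toℕ-ξ⊠one₁-↑ˡ i = begin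
    toℕ (lookup V (cast e (i ↑ˡ suc b))) ≡⟨ cong toℕ (lookup-cast V e (trans (FinP.toℕ-↑ˡ i (suc b))
                                              (sym (trans (FinP.toℕ-↑ˡ (i ↑ˡ b) 1) (FinP.toℕ-↑ˡ i b))))) ⟩
    toℕ (lookup V ((i ↑ˡ b) ↑ˡ 1))       ≡⟨ toℕ-lookup-⊠-↑ˡ (ξ a b) one₁ (i ↑ˡ b) ⟩
    toℕ (lookup (ξ a b) (i ↑ˡ b))        ≡⟨ toℕ-lookup-ξ-↑ˡ a b i ⟩
    b + toℕ i                            ∎
    where open ≡-Reasoning

  toℕ-ξ⊠one₁-inject₁ : ∀ j → toℕ (lookup V (cast e (a ↑ʳ inject₁ j))) ≡ toℕ j
  toℕ-ξ⊠one₁-inject₁ j = begin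
    toℕ (lookup V (cast e (a ↑ʳ inject₁ j))) ≡⟨ cong toℕ (lookup-cast V e
                  (trans (FinP.toℕ-↑ʳ a (inject₁ j)) (trans (cong (a +_) (FinP.toℕ-inject₁ j))
                  (sym (trans (FinP.toℕ-↑ˡ (a ↑ʳ j) 1) (FinP.toℕ-↑ʳ a j)))))) ⟩
    toℕ (lookup V ((a ↑ʳ j) ↑ˡ 1))           ≡⟨ toℕ-lookup-⊠-↑ˡ (ξ a b) one₁ (a ↑ʳ j) ⟩
    toℕ (lookup (ξ a b) (a ↑ʳ j))            ≡⟨ toℕ-lookup-ξ-↑ʳ a b j ⟩
    toℕ j                                    ∎
    where open ≡-Reasoning

  toℕ-ξ⊠one₁-last : toℕ (lookup V (cast e (a ↑ʳ fromℕ b))) ≡ b + a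
  toℕ-ξ⊠one₁-last = begin
    toℕ (lookup V (cast e (a ↑ʳ fromℕ b))) ≡⟨ cong toℕ (lookup-cast V e
                  (trans (FinP.toℕ-↑ʳ a (fromℕ b)) (trans (cong (a +_) (FinP.toℕ-fromℕ b))
                  (sym (trans (FinP.toℕ-↑ʳ (a + b) zero) (+-identityʳ _)))))) ⟩
    toℕ (lookup V ((a + b) ↑ʳ zero))       ≡⟨ toℕ-lookup-⊠-↑ʳ (ξ a b) one₁ zero ⟩
    (a + b) + 0                            ≡⟨ trans (+-identityʳ (a + b)) (+-comm a b) ⟩
    b + a                                  ∎
    where open ≡-Reasoning

module ShuffleProduct {n m} (r₁ s₁ : ℕ) (γ : Vec (Fin (suc r₁)) n) (δ : Vec (Fin (suc s₁)) m)
                 (γ-surj : Surj γ) (δ-surj : Surj δ) where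

  γδ : Vec (Fin (suc r₁ + suc s₁)) (n + m)
  γδ = γ ⊠ δ

  -- ω ∘ (γ × δ) for the shuffle ω given by a word.
  ω∘γδ : Shuffle (suc r₁) (suc s₁) t → Vec (Fin t) (n + m)
  ω∘γδ w = map (lmap w) γ ++ map (rmap w) δ

  shape : Shuffles (suc r₁) (suc s₁) → Obj (n + m)
  shape (t , w) = t , ω∘γδ w

  shape-surj : (w : Shuffle (suc r₁) (suc s₁) t) → Surj (ω∘γδ w)
  shape-surj w j with lmap-rmap-cover w j
  ... | inj₁ (a , refl) = VecM.∈-++⁺ˡ (VecM.∈-map⁺ (lmap w) (γ-surj a))
  ... | inj₂ (b , refl) = VecM.∈-++⁺ʳ _ (VecM.∈-map⁺ (rmap w) (δ-surj b))

  map-tmap-shape : ∀ {o k i} {big : Shuffle (suc r₁) (suc s₁) (suc (suc k))} {small} → Fusion o i big small →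
                   map (tmap i) (ω∘γδ big) ≡ ω∘γδ small
  map-tmap-shape {i = i} {big} f = trans (VecP.map-++ (tmap i) (map (lmap big) γ) _) (cong₂ _++_
    (trans (sym (VecP.map-∘ (tmap i) (lmap big) γ)) (VecP.map-cong (sym ∘ fusion-lmap f) γ))
    (trans (sym (VecP.map-∘ (tmap i) (rmap big) δ)) (VecP.map-cong (sym ∘ fusion-rmap f) δ)))

  lookup-shape-↑ˡ : (w : Shuffle (suc r₁) (suc s₁) t) (a : Fin n) →
                    lookup (ω∘γδ w) (a ↑ˡ m) ≡ lmap w (lookup γ a)
  lookup-shape-↑ˡ w = lookup-map-++ˡ (lmap w) (rmap w) γ δ

  lookup-shape-↑ʳ : (w : Shuffle (suc r₁) (suc s₁) t) (b : Fin m) →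
                    lookup (ω∘γδ w) (n ↑ʳ b) ≡ rmap w (lookup δ b)
  lookup-shape-↑ʳ w = lookup-map-++ʳ (lmap w) (rmap w) γ δ

  -- In the word, the values involved in a fusion are hit by one block only, so their
  -- positions in ω ∘ (γ × δ) lie in the corresponding half.
  merge⇒BStep : ∀ {k i} {big : Shuffle (suc r₁) (suc s₁) (suc (suc k))} {small} →
                Fusion left-first i big small → BStep (shape (_ , big)) (shape (_ , small))
  merge⇒BStep {i = i} {big} f =
    subst (BStep (shape (_ , big)) ∘ (_ ,_)) (map-tmap-shape f) (up _ i (shape-surj big) before)
    where
    before : BlocksLt (ω∘γδ big) i
    before p q vp vq = go (splitView n m p) (splitView n m q) vp vq
      where
      go : ∀ {p q} → SplitView n m p → SplitView n m q → lookup (ω∘γδ big) p ≡ inject₁ i →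
           lookup (ω∘γδ big) q ≡ suc i → p <ᶠ q
      go (inr b) _       vp _  =
        ⊥-elim (proj₁ (fusion-separated f) _ (trans (sym (lookup-shape-↑ʳ big b)) vp))
      go (inl a) (inl _) _  vq =
        ⊥-elim (proj₂ (fusion-separated f) _ (trans (sym (lookup-shape-↑ˡ big _)) vq))
      go (inl a) (inr b) _  _  = ↑ˡ<↑ʳ a b

  split⇒BStep : ∀ {k i} {big : Shuffle (suc r₁) (suc s₁) (suc (suc k))} {small} →
                Fusion right-first i big small → BStep (shape (_ , small)) (shape (_ , big))
  split⇒BStep {i = i} {big} f =
    subst (λ v → BStep (_ , v) (shape (_ , big))) (map-tmap-shape f) (down _ i (shape-surj big) after)
    where
    after : BlocksGt (ω∘γδ big) i
    after p q vp vq = go (splitView n m p) (splitView n m q) vp vq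
      where
      go : ∀ {p q} → SplitView n m p → SplitView n m q → lookup (ω∘γδ big) p ≡ inject₁ i →
           lookup (ω∘γδ big) q ≡ suc i → q <ᶠ p
      go (inl a) _       vp _  =
        ⊥-elim (proj₁ (fusion-separated f) _ (trans (sym (lookup-shape-↑ˡ big a)) vp))
      go (inr b) (inr _) _  vq =
        ⊥-elim (proj₂ (fusion-separated f) _ (trans (sym (lookup-shape-↑ʳ big _)) vq))
      go (inr b) (inl a) _  _  = ↑ˡ<↑ʳ a b

  ≤ˢ⇒≤B : ∀ {x y} → x ≤ˢ y → shape x ≤B shape y
  ≤ˢ⇒≤B = gmap shape λ where
    (merge f) → merge⇒BStep f
    (split f) → split⇒BStep f

  cmpAt-shape-γ : (x : Shuffles (suc r₁) (suc s₁)) (a a' : Fin n) →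
                  cmpAt (shape x) (a ↑ˡ m) (a' ↑ˡ m) ≡ cmpᶠ (lookup γ a) (lookup γ a')
  cmpAt-shape-γ (_ , w) a a' = trans (cong₂ cmpᶠ (lookup-shape-↑ˡ w a) (lookup-shape-↑ˡ w a'))
                                     (cmpᶠ-strictMono (lmap-strictMono w) _ _)

  cmpAt-shape-δ : (x : Shuffles (suc r₁) (suc s₁)) (b b' : Fin m) →
                  cmpAt (shape x) (n ↑ʳ b) (n ↑ʳ b') ≡ cmpᶠ (lookup δ b) (lookup δ b')
  cmpAt-shape-δ (_ , w) b b' = trans (cong₂ cmpᶠ (lookup-shape-↑ʳ w b) (lookup-shape-↑ʳ w b'))
                                     (cmpᶠ-strictMono (rmap-strictMono w) _ _)

  -- Positions of γ × δ carrying the values r and r + s.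
  pᵣ qₛ : Fin (n + m)
  pᵣ = section γ γ-surj (fromℕ r₁) ↑ˡ m
  qₛ = n ↑ʳ section δ δ-surj (fromℕ s₁)

  cmpAt-shape-pᵣqₛ : (x : Shuffles (suc r₁) (suc s₁)) → cmpAt (shape x) pᵣ qₛ ≡ lastCmp (proj₂ x)
  cmpAt-shape-pᵣqₛ (_ , w) = cong₂ cmpᶠ
    (trans (lookup-shape-↑ˡ w _) (cong (lmap w) (lookup-section γ γ-surj _)))
    (trans (lookup-shape-↑ʳ w _) (cong (rmap w) (lookup-section δ δ-surj _)))

  lookup-comp : ∀ {t} (σ : Vec (Fin t) (suc r₁ + suc s₁)) p →
                lookup (comp σ γδ refl) p ≡ lookup σ (lookup γδ p)
  lookup-comp σ p = trans (VecP.lookup-map p _ γδ) (cong (lookup σ) (FinP.cast-is-id refl _))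

  lastCmpᵛ : Obj (suc r₁ + suc s₁) → ℕ
  lastCmpᵛ o = cmpᶠ (ωr r₁ s₁ o) (ωrs r₁ s₁ o)

  record Factorisation {t} (v : Vec (Fin t) (n + m)) : Set where
    field
      σ         : Vec (Fin t) (suc r₁ + suc s₁)
      σ-surj    : Surj σ
      σ-shuffle : IsShuffle r₁ s₁ (t , σ)
      σ∘γδ≡v    : comp σ γδ refl ≡ v
      lastCmp-σ : lastCmpᵛ (t , σ) ≡ cmpAt (t , v) pᵣ qₛ

  comp-tabulate₂ : ∀ {t} (f : Fin (suc r₁) → Fin t) (g : Fin (suc s₁) → Fin t) →
                   comp (tabulate₂ f g) γδ refl ≡ map f γ ++ map g δ
  comp-tabulate₂ f g = ++-ext
    (λ a → trans (lookup-comp (tabulate₂ f g) _)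
           (trans (cong (lookup (tabulate₂ f g)) (lookup-map-++ˡ _ _ γ δ a))
           (trans (lookup-tabulate₂-↑ˡ f g _) (sym (lookup-map-++ˡ f g γ δ a)))))
    (λ b → trans (lookup-comp (tabulate₂ f g) _)
           (trans (cong (lookup (tabulate₂ f g)) (lookup-map-++ʳ _ _ γ δ b))
           (trans (lookup-tabulate₂-↑ʳ f g _) (sym (lookup-map-++ʳ f g γ δ b)))))

  comp-toVec : (w : Shuffle (suc r₁) (suc s₁) t) → (t , comp (toVec w) γδ refl) ≡ shape (t , w)
  comp-toVec w = cong (_ ,_) (comp-tabulate₂ (lmap w) (rmap w))

  module _ (x y : Shuffles (suc r₁) (suc s₁)) {t} {v : Vec (Fin t) (n + m)}
           (x≤v : shape x ≤B (t , v)) (v≤y : (t , v) ≤B shape y) where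

    interval-frozen-γ : SamePattern γ γ-surj (λ a → lookup v (a ↑ˡ m))
    interval-frozen-γ {a} {a'} a<a' =
      cmpAt-squeeze x≤v v≤y (↑ˡ-mono-< m a<a') (cmpAt-shape-γ x a a') (cmpAt-shape-γ y a a')

    interval-frozen-δ : SamePattern δ δ-surj (λ b → lookup v (n ↑ʳ b))
    interval-frozen-δ {b} {b'} b<b' =
      cmpAt-squeeze x≤v v≤y (↑ʳ-mono-< n b<b') (cmpAt-shape-δ x b b') (cmpAt-shape-δ y b b')

    factorise-interval : Surj v → Factorisation v
    factorise-interval v-surj
      with factorise γ γ-surj _ interval-frozen-γ | factorise δ δ-surj _ interval-frozen-δ
    ... | Fγ , Fγ-mono , vγ≡ | Fδ , Fδ-mono , vδ≡ = record
      { σ         = σ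
      ; σ-surj    = σ-surj
      ; σ-shuffle = tabulate₂-shuffle Fγ Fδ Fγ-mono Fδ-mono
      ; σ∘γδ≡v    = trans (comp-tabulate₂ Fγ Fδ) (sym v≡)
      ; lastCmp-σ = cong₂ cmpᶠ
          (trans (ωr-tabulate₂ Fγ Fδ) (trans (cong Fγ (sym (lookup-section γ γ-surj _))) (sym (vγ≡ _))))
          (trans (ωrs-tabulate₂ Fγ Fδ) (trans (cong Fδ (sym (lookup-section δ δ-surj _))) (sym (vδ≡ _))))
      }
      where
      σ : Vec (Fin t) (suc r₁ + suc s₁)
      σ = tabulate₂ Fγ Fδ

      v≡ : v ≡ map Fγ γ ++ map Fδ δ
      v≡ = ++-ext (λ a → trans (vγ≡ a) (sym (lookup-map-++ˡ Fγ Fδ γ δ a)))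
                  (λ b → trans (vδ≡ b) (sym (lookup-map-++ʳ Fγ Fδ γ δ b)))

      σ-surj : Surj σ
      σ-surj j = go (splitView n m (section v v-surj j)) (lookup-section v v-surj j)
        where
        go : ∀ {p} → SplitView n m p → lookup v p ≡ j → j ∈ᵥ σ
        go (inl a) vp≡j = subst (_∈ᵥ σ) (trans (lookup-tabulate₂-↑ˡ Fγ Fδ _) (trans (sym (vγ≡ a)) vp≡j))
                                (VecM.∈-lookup (lookup γ a ↑ˡ suc s₁) σ)
        go (inr b) vp≡j = subst (_∈ᵥ σ) (trans (lookup-tabulate₂-↑ʳ Fγ Fδ _) (trans (sym (vδ≡ b)) vp≡j))
                                (VecM.∈-lookup (suc r₁ ↑ʳ lookup δ b) σ)

  embed : Obj (suc r₁ + suc s₁) → Basis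
  embed (t , σ) = n + m , t , comp σ γδ refl

  γδ-surj : Surj γδ
  γδ-surj x = go (splitView (suc r₁) (suc s₁) x)
    where
    go : ∀ {x} → SplitView (suc r₁) (suc s₁) x → x ∈ᵥ γδ
    go (inl a) = VecM.∈-++⁺ˡ (VecM.∈-map⁺ (_↑ˡ suc s₁) (γ-surj a))
    go (inr b) = VecM.∈-++⁺ʳ _ (VecM.∈-map⁺ (suc r₁ ↑ʳ_) (δ-surj b))

  embed-injective : ∀ {o o'} → embed o ≡ embed o' → o ≡ o'
  embed-injective {t , σ} {_ , σ'} eq with ,-injectiveˡ (,-injectiveʳ-UIP ≡-irrelevant eq)
  ... | refl = cong (t ,_) (vec-ext λ x → begin
    lookup σ x                                ≡⟨ cong (lookup σ) (sym (lookup-section γδ γδ-surj x)) ⟩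
    lookup σ (lookup γδ (section γδ γδ-surj x)) ≡⟨ sym (lookup-comp σ _) ⟩
    lookup (comp σ γδ refl) (section γδ γδ-surj x)
      ≡⟨ cong (λ v → lookup v (section γδ γδ-surj x))
              (,-injectiveʳ-UIP ≡-irrelevant (,-injectiveʳ-UIP ≡-irrelevant eq)) ⟩
    lookup (comp σ' γδ refl) (section γδ γδ-surj x) ≡⟨ lookup-comp σ' _ ⟩
    lookup σ' (lookup γδ (section γδ γδ-surj x)) ≡⟨ cong (lookup σ') (lookup-section γδ γδ-surj x) ⟩
    lookup σ' x                               ∎)
    where open ≡-Reasoning

  lastCmpᵛ-toVec : (w : Shuffle (suc r₁) (suc s₁) t) → lastCmpᵛ (t , toVec w) ≡ lastCmp w
  lastCmpᵛ-toVec w = cong₂ cmpᶠ (ωr-tabulate₂ (lmap w) (rmap w)) (ωrs-tabulate₂ (lmap w) (rmap w))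

  InSH : Obj (suc r₁ + suc s₁) → Set
  InSH (t , σ) = Surj σ × IsShuffle r₁ s₁ (t , σ)

  record CutOut (S : List (Obj (suc r₁ + suc s₁))) (Q : ℕ → Set) : Set where
    field
      unique : Unique S
      ∈⁻     : ∀ {o} → o ∈ₗ S → InSH o × Q (lastCmpᵛ o)
      ∈⁺     : ∀ {o} → InSH o → Q (lastCmpᵛ o) → o ∈ₗ S

  module _ {c ℓ} (K : Field c ℓ) {S : List (Obj (suc r₁ + suc s₁))} {Q : ℕ → Set} (cut : CutOut S Q)
           (x y : Shuffles (suc r₁) (suc s₁))
           (between : ∀ {t} (w : Shuffle (suc r₁) (suc s₁) t) → Q (lastCmp w) → x ≤ˢ (t , w) × (t , w) ≤ˢ y)
           (Q-interval : ∀ {o} → shape x ≤B o → o ≤B shape y → Q (cmpAt o pᵣ qₛ)) where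

    open CutOut cut

    shuffleSum-≐Σ : _≐Σ_ {k = K} (coeff K (shuffleSum S γ δ)) (InInterval (shape x) (shape y))
    shuffleSum-≐Σ = coeff-≐Σ K (UniqueP.map⁺ embed-injective unique) complete sound
      where
      complete : ∀ {τ} → InP∞ τ → InInterval (shape x) (shape y) τ → τ ∈ₗ shuffleSum S γ δ
      complete v-surj ((t , v) , refl , x≤v , v≤y) =
        subst (_∈ₗ shuffleSum S γ δ) (cong (λ u → n + m , t , u) σ∘γδ≡v)
          (∈-map⁺ embed (∈⁺ (σ-surj , σ-shuffle) (subst Q (sym lastCmp-σ) (Q-interval x≤v v≤y))))
        where open Factorisation (factorise-interval x y x≤v v≤y v-surj)

      sound : ∀ {τ} → τ ∈ₗ shuffleSum S γ δ → InInterval (shape x) (shape y) τ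
      sound τ∈ with ∈-map⁻ embed τ∈
      ... | (t , σ) , o∈ , refl with ∈⁻ o∈
      ...   | (σ-surj , σ-shuffle) , q with shuffle⇒toVec σ σ-surj σ-shuffle
      ...     | w , refl with between w (subst Q (lastCmpᵛ-toVec w) q)
      ...       | x≤w , w≤y =
        _ , refl , subst (shape x ≤B_) (sym (comp-toVec w)) (≤ˢ⇒≤B x≤w)
                 , subst (_≤B shape y) (sym (comp-toVec w)) (≤ˢ⇒≤B w≤y)

  map≡shape : ∀ {t t'} (h : Fin (suc r₁ + suc s₁) → Fin t) (w : Shuffle (suc r₁) (suc s₁) t') → t ≡ t' →
              (∀ a → toℕ (h (a ↑ˡ suc s₁)) ≡ toℕ (lmap w a)) →
              (∀ b → toℕ (h (suc r₁ ↑ʳ b)) ≡ toℕ (rmap w b)) →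
              (t , map h γδ) ≡ shape (t' , w)
  map≡shape h w refl onL onR = cong (_ ,_) (trans (VecP.map-++ h (map (_↑ˡ suc s₁) γ) _) (cong₂ _++_
    (trans (sym (VecP.map-∘ h _ γ)) (VecP.map-cong (FinP.toℕ-injective ∘ onL) γ))
    (trans (sym (VecP.map-∘ h _ δ)) (VecP.map-cong (FinP.toℕ-injective ∘ onR) δ))))

  shape-bottom : shape (_ , bottom (suc r₁) (suc s₁)) ≡ (_ , γδ)
  shape-bottom = sym (trans (cong (_ ,_) (sym (VecP.map-id γδ))) (map≡shape (λ x → x) _ refl
    (λ a → trans (FinP.toℕ-↑ˡ a _) (sym (toℕ-lmap-bottom _ _ a)))
    (λ b → trans (FinP.toℕ-↑ʳ _ b) (sym (toℕ-rmap-bottom _ _ b)))))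

  shape-top : shape (_ , top (suc r₁) (suc s₁)) ≡ (_ , comp (ξ (suc r₁) (suc s₁)) γδ refl)
  shape-top = sym (map≡shape _ _ (+-comm (suc r₁) (suc s₁))
    (λ a → trans (cong toℕ (lookup-cast (ξ (suc r₁) (suc s₁)) refl {j = a ↑ˡ suc s₁} refl))
                 (trans (toℕ-lookup-ξ-↑ˡ (suc r₁) (suc s₁) a) (sym (toℕ-lmap-top (suc r₁) (suc s₁) a))))
    (λ b → trans (cong toℕ (lookup-cast (ξ (suc r₁) (suc s₁)) refl {j = suc r₁ ↑ʳ b} refl))
                 (trans (toℕ-lookup-ξ-↑ʳ (suc r₁) (suc s₁) b) (sym (toℕ-rmap-top (suc r₁) (suc s₁) b)))))

  shape-top∷r : shape (_ , top (suc r₁) s₁ ∷r) ≡ (_ , comp (ξ (suc r₁) s₁ ⊠ one₁) γδ (eq≻ r₁ s₁))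
  shape-top∷r = sym (map≡shape _ _ (trans (+-comm _ 1) (cong suc (+-comm (suc r₁) s₁)))
    (λ a → trans (toℕ-ξ⊠one₁-↑ˡ (suc r₁) s₁ (eq≻ r₁ s₁) a)
                 (sym (trans (toℕ-lmap-∷r _ a) (toℕ-lmap-top _ s₁ a))))
    onR)
    where
    onR : ∀ b → toℕ (lookup (ξ (suc r₁) s₁ ⊠ one₁) (cast (eq≻ r₁ s₁) (suc r₁ ↑ʳ b)))
              ≡ toℕ (rmap (top (suc r₁) s₁ ∷r) b)
    onR b with lastView b
    ... | is-inject b = trans (toℕ-ξ⊠one₁-inject₁ (suc r₁) s₁ (eq≻ r₁ s₁) b)
                              (sym (trans (toℕ-rmap-∷r-inject₁ _ b) (toℕ-rmap-top _ s₁ b)))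
    ... | is-last = trans (toℕ-ξ⊠one₁-last (suc r₁) s₁ (eq≻ r₁ s₁)) (sym (toℕ-rmap-∷r-last _))

  z₀-lookup : Fin (suc r₁ + suc s₁) → Fin (r₁ + suc s₁)
  z₀-lookup x = lookup (z₀ r₁ s₁) (cast (eq•₁ r₁ s₁) x)

  z₀-lookup-↑ʳ : ∀ b → z₀-lookup (suc r₁ ↑ʳ b) ≡ r₁ ↑ʳ b
  z₀-lookup-↑ʳ b = trans (lookup-allFin⊠∷-↑ʳ r₁ (fromℕ s₁) (allFin (suc s₁)) (eq•₁ r₁ s₁) b)
                         (cong (r₁ ↑ʳ_) (VecP.lookup-allFin b))

  shape-bottom∷lr : shape (_ , bottom r₁ s₁ ∷lr) ≡ (_ , comp (z₀ r₁ s₁) γδ (eq•₁ r₁ s₁))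
  shape-bottom∷lr = sym (map≡shape z₀-lookup _ (+-suc r₁ s₁) onL onR)
    where
    at-last : toℕ (r₁ ↑ʳ fromℕ s₁) ≡ r₁ + s₁
    at-last = trans (FinP.toℕ-↑ʳ r₁ _) (cong (r₁ +_) (FinP.toℕ-fromℕ s₁))
    onL : ∀ a → toℕ (z₀-lookup (a ↑ˡ suc s₁)) ≡ toℕ (lmap (bottom r₁ s₁ ∷lr) a)
    onL a with lastView a
    ... | is-inject a =
      trans (cong toℕ (lookup-allFin⊠∷-inject₁ r₁ (fromℕ s₁) (allFin (suc s₁)) (eq•₁ r₁ s₁) a))
            (trans (FinP.toℕ-↑ˡ a _) (sym (trans (toℕ-lmap-∷lr-inject₁ _ a) (toℕ-lmap-bottom r₁ s₁ a))))
    ... | is-last =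
      trans (cong toℕ (lookup-allFin⊠∷-last r₁ (fromℕ s₁) (allFin (suc s₁)) (eq•₁ r₁ s₁)))
            (trans at-last (sym (toℕ-lmap-∷lr-last _)))
    onR : ∀ b → toℕ (z₀-lookup (suc r₁ ↑ʳ b)) ≡ toℕ (rmap (bottom r₁ s₁ ∷lr) b)
    onR b with lastView b
    ... | is-inject b =
      trans (cong toℕ (z₀-lookup-↑ʳ (inject₁ b)))
            (trans (trans (FinP.toℕ-↑ʳ r₁ _) (cong (r₁ +_) (FinP.toℕ-inject₁ b)))
                   (sym (trans (toℕ-rmap-∷lr-inject₁ _ b) (toℕ-rmap-bottom r₁ s₁ b))))
    ... | is-last = trans (cong toℕ (z₀-lookup-↑ʳ (fromℕ s₁))) (trans at-last (sym (toℕ-rmap-∷lr-last _)))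

  shape-top∷lr : shape (_ , top r₁ s₁ ∷lr)
               ≡ (_ , comp (ξ r₁ s₁ ⊠ one₁) (comp (z₀ r₁ s₁) γδ (eq•₁ r₁ s₁)) (eq•₂ r₁ s₁))
  shape-top∷lr = sym (trans (cong (_ ,_) (sym (VecP.map-∘ ξ⊠one₁-lookup z₀-lookup γδ)))
    (map≡shape (ξ⊠one₁-lookup ∘ z₀-lookup) _ (trans (+-comm _ 1) (cong suc (+-comm r₁ s₁))) onL onR))
    where
    ξ⊠one₁-lookup : Fin (r₁ + suc s₁) → Fin ((r₁ + s₁) + 1)
    ξ⊠one₁-lookup y = lookup (ξ r₁ s₁ ⊠ one₁) (cast (eq•₂ r₁ s₁) y)
    onL : ∀ a → toℕ (ξ⊠one₁-lookup (z₀-lookup (a ↑ˡ suc s₁))) ≡ toℕ (lmap (top r₁ s₁ ∷lr) a)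
    onL a with lastView a
    ... | is-inject a =
      trans (cong (toℕ ∘ ξ⊠one₁-lookup)
                  (lookup-allFin⊠∷-inject₁ r₁ (fromℕ s₁) (allFin (suc s₁)) (eq•₁ r₁ s₁) a))
            (trans (toℕ-ξ⊠one₁-↑ˡ r₁ s₁ (eq•₂ r₁ s₁) a)
                   (sym (trans (toℕ-lmap-∷lr-inject₁ _ a) (toℕ-lmap-top r₁ s₁ a))))
    ... | is-last =
      trans (cong (toℕ ∘ ξ⊠one₁-lookup)
                  (lookup-allFin⊠∷-last r₁ (fromℕ s₁) (allFin (suc s₁)) (eq•₁ r₁ s₁)))
            (trans (toℕ-ξ⊠one₁-last r₁ s₁ (eq•₂ r₁ s₁)) (sym (toℕ-lmap-∷lr-last _)))
    onR : ∀ b → toℕ (ξ⊠one₁-lookup (z₀-lookup (suc r₁ ↑ʳ b))) ≡ toℕ (rmap (top r₁ s₁ ∷lr) b)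
    onR b with lastView b
    ... | is-inject b =
      trans (cong (toℕ ∘ ξ⊠one₁-lookup) (z₀-lookup-↑ʳ (inject₁ b)))
            (trans (toℕ-ξ⊠one₁-inject₁ r₁ s₁ (eq•₂ r₁ s₁) b)
                   (sym (trans (toℕ-rmap-∷lr-inject₁ _ b) (toℕ-rmap-top r₁ s₁ b))))
    ... | is-last =
      trans (cong (toℕ ∘ ξ⊠one₁-lookup) (z₀-lookup-↑ʳ (fromℕ s₁)))
            (trans (toℕ-ξ⊠one₁-last r₁ s₁ (eq•₂ r₁ s₁)) (sym (toℕ-rmap-∷lr-last _)))

  shape-bottom∷l : shape (_ , bottom r₁ (suc s₁) ∷l) ≡ (_ , comp (z r₁ (suc s₁)) γδ (eq≺ r₁ s₁))
  shape-bottom∷l = sym (map≡shape _ _ (+-suc r₁ (suc s₁)) onL onR)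
    where
    tail : Vec (Fin (suc (suc s₁))) (suc s₁)
    tail = map inject₁ (allFin (suc s₁))
    onL : ∀ a → toℕ (lookup (z r₁ (suc s₁)) (cast (eq≺ r₁ s₁) (a ↑ˡ suc s₁)))
              ≡ toℕ (lmap (bottom r₁ (suc s₁) ∷l) a)
    onL a with lastView a
    ... | is-inject a =
      trans (cong toℕ (lookup-allFin⊠∷-inject₁ r₁ (fromℕ (suc s₁)) tail (eq≺ r₁ s₁) a))
            (trans (FinP.toℕ-↑ˡ a _) (sym (trans (toℕ-lmap-∷l-inject₁ _ a) (toℕ-lmap-bottom r₁ (suc s₁) a))))
    ... | is-last =
      trans (cong toℕ (lookup-allFin⊠∷-last r₁ (fromℕ (suc s₁)) tail (eq≺ r₁ s₁)))
            (trans (trans (FinP.toℕ-↑ʳ r₁ _) (cong (r₁ +_) (FinP.toℕ-fromℕ (suc s₁))))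
                   (sym (toℕ-lmap-∷l-last _)))
    onR : ∀ b → toℕ (lookup (z r₁ (suc s₁)) (cast (eq≺ r₁ s₁) (suc r₁ ↑ʳ b)))
              ≡ toℕ (rmap (bottom r₁ (suc s₁) ∷l) b)
    onR b = trans (cong toℕ (lookup-allFin⊠∷-↑ʳ r₁ (fromℕ (suc s₁)) tail (eq≺ r₁ s₁) b))
      (trans (FinP.toℕ-↑ʳ r₁ _)
      (trans (cong (λ j → r₁ + toℕ j) (trans (VecP.lookup-map b inject₁ (allFin (suc s₁)))
                                             (cong inject₁ (VecP.lookup-allFin b))))
      (trans (cong (r₁ +_) (FinP.toℕ-inject₁ b))
             (sym (trans (toℕ-rmap-∷l _ b) (toℕ-rmap-bottom r₁ (suc s₁) b))))))

  SH-cutOut : CutOut (SH r₁ s₁) (λ _ → ⊤)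
  SH-cutOut = record
    { unique = UniqueP.filter⁺ (isShuffle? r₁ s₁) (allP-unique _)
    ; ∈⁻     = λ o∈ → let o∈allP , o-shuffle = ∈-filter⁻ (isShuffle? r₁ s₁) {xs = allP _} o∈
                      in (∈-allP⁻ o∈allP , o-shuffle) , tt
    ; ∈⁺     = λ (σ-surj , σ-shuffle) _ → ∈-filter⁺ (isShuffle? r₁ s₁) (∈-allP _ σ-surj) σ-shuffle
    }

  filter-cutOut : ∀ {P : Obj (suc r₁ + suc s₁) → Set} (P? : Decidable P) {Q : ℕ → Set} →
                  (∀ {o} → P o → Q (lastCmpᵛ o)) → (∀ {o} → Q (lastCmpᵛ o) → P o) →
                  CutOut (filter P? (SH r₁ s₁)) Q
  filter-cutOut P? P⇒Q Q⇒P = record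
    { unique = UniqueP.filter⁺ P? (CutOut.unique SH-cutOut)
    ; ∈⁻     = λ o∈ → let o∈SH , Po = ∈-filter⁻ P? {xs = SH r₁ s₁} o∈
                      in proj₁ (CutOut.∈⁻ SH-cutOut o∈SH) , P⇒Q Po
    ; ∈⁺     = λ o∈SH Qo → ∈-filter⁺ P? (CutOut.∈⁺ SH-cutOut o∈SH tt) (Q⇒P Qo)
    }

  cmpAt-interval : ∀ {x y o c} → shape x ≤B o → o ≤B shape y →
                   lastCmp (proj₂ x) ≡ c → lastCmp (proj₂ y) ≡ c → cmpAt o pᵣ qₛ ≡ c
  cmpAt-interval {x} {y} x≤o o≤y x≡c y≡c = cmpAt-squeeze x≤o o≤y (↑ˡ<↑ʳ _ _)
    (trans (cmpAt-shape-pᵣqₛ x) x≡c) (trans (cmpAt-shape-pᵣqₛ y) y≡c)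

  module _ {c ℓ} (K : Field c ℓ) where

    interval-cong : ∀ {S} {lo lo' hi hi' : Obj (n + m)} → lo ≡ lo' → hi ≡ hi' →
                    _≐Σ_ {k = K} (coeff K (shuffleSum S γ δ)) (InInterval lo hi) →
                    _≐Σ_ {k = K} (coeff K (shuffleSum S γ δ)) (InInterval lo' hi')
    interval-cong refl refl sum = sum

    ≻-interval : _≐Σ_ {k = K} (coeff K (shuffleSum (SH≻ r₁ s₁) γ δ))
                   (InInterval (suc r₁ + suc s₁ , γδ)
                               (_ , comp (ξ (suc r₁) s₁ ⊠ one₁) γδ (eq≻ r₁ s₁)))
    ≻-interval = interval-cong {SH≻ r₁ s₁} shape-bottom shape-top∷r
      (shuffleSum-≐Σ K (filter-cutOut _ {_≡ 0} cmpCode-< cmpCode≡0⇒<) _ _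
        (λ w c≡0 → bottom-≤ˢ w , lastCmp≡0⇒≤ˢ-top∷r w c≡0)
        (λ x≤o o≤y → cmpAt-interval x≤o o≤y (lastCmp-bottom r₁ s₁) (lastCmp-∷r (top (suc r₁) s₁))))

    •-interval : let zγδ = comp (z₀ r₁ s₁) γδ (eq•₁ r₁ s₁) in
                 _≐Σ_ {k = K} (coeff K (shuffleSum (SH• r₁ s₁) γ δ))
                   (InInterval (_ , zγδ) (_ , comp (ξ r₁ s₁ ⊠ one₁) zγδ (eq•₂ r₁ s₁)))
    •-interval = interval-cong {SH• r₁ s₁} shape-bottom∷lr shape-top∷lr
      (shuffleSum-≐Σ K (filter-cutOut _ {_≡ 1} cmpᶠ-≡ (FinP.toℕ-injective ∘ cmpCode≡1⇒≡)) _ _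
        lastCmp≡1⇒∈[bottom∷lr,top∷lr]
        (λ x≤o o≤y →
           cmpAt-interval x≤o o≤y (lastCmp-∷lr (bottom r₁ s₁)) (lastCmp-∷lr (top r₁ s₁))))

    ≺-interval : _≐Σ_ {k = K} (coeff K (shuffleSum (SH≺ r₁ s₁) γ δ))
                   (InInterval (_ , comp (z r₁ (suc s₁)) γδ (eq≺ r₁ s₁))
                               (suc r₁ + suc s₁ , comp (ξ (suc r₁) (suc s₁)) γδ refl))
    ≺-interval = interval-cong {SH≺ r₁ s₁} shape-bottom∷l shape-top
      (shuffleSum-≐Σ K (filter-cutOut _ {_≡ 2} cmpCode-> cmpCode≡2⇒>) _ _
        (λ w c≡2 → lastCmp≡2⇒bottom∷l-≤ˢ w c≡2 , ≤ˢ-top w)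
        (λ x≤o o≤y → cmpAt-interval x≤o o≤y (lastCmp-∷l (bottom r₁ (suc s₁))) (lastCmp-top r₁ s₁)))

    *-interval : _≐Σ_ {k = K} (coeff K (shuffleSum (SH r₁ s₁) γ δ))
                   (InInterval (suc r₁ + suc s₁ , γδ)
                               (suc r₁ + suc s₁ , comp (ξ (suc r₁) (suc s₁)) γδ refl))
    *-interval = interval-cong {SH r₁ s₁} shape-bottom shape-top
      (shuffleSum-≐Σ K SH-cutOut _ _ (λ w _ → bottom-≤ˢ w , ≤ˢ-top w) (λ _ _ → tt))

mainTheorem11 : ∀ {c ℓ} (k : Field c ℓ) (n₁ m₁ r₁ s₁ : ℕ)
    (γ : Vec (Fin (suc r₁)) (suc n₁)) (δ : Vec (Fin (suc s₁)) (suc m₁)) →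
    Surj γ → Surj δ →
    let γδ = γ ⊠ δ
        zγδ = comp (z₀ r₁ s₁) γδ (eq•₁ r₁ s₁)
    in (_≐Σ_ {k = k} (coeff k (shuffleSum (SH≻ r₁ s₁) γ δ))
          (InInterval (suc r₁ + suc s₁ , γδ)
                      (_ , comp (ξ (suc r₁) s₁ ⊠ one₁) γδ (eq≻ r₁ s₁))))
     × (_≐Σ_ {k = k} (coeff k (shuffleSum (SH• r₁ s₁) γ δ))
          (InInterval (_ , zγδ)
                      (_ , comp (ξ r₁ s₁ ⊠ one₁) zγδ (eq•₂ r₁ s₁))))
     × (_≐Σ_ {k = k} (coeff k (shuffleSum (SH≺ r₁ s₁) γ δ))
          (InInterval (_ , comp (z r₁ (suc s₁)) γδ (eq≺ r₁ s₁))
                      (suc r₁ + suc s₁ , comp (ξ (suc r₁) (suc s₁)) γδ refl)))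
     × (_≐Σ_ {k = k} (coeff k (shuffleSum (SH r₁ s₁) γ δ))
          (InInterval (suc r₁ + suc s₁ , γδ)
                      (suc r₁ + suc s₁ , comp (ξ (suc r₁) (suc s₁)) γδ refl)))
mainTheorem11 k n₁ m₁ r₁ s₁ γ δ γ-surj δ-surj =
  ≻-interval k , •-interval k , ≺-interval k , *-interval k
  where open ShuffleProduct r₁ s₁ γ δ γ-surj δ-surj
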